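{- Let $n\ge 10$ and $I\in\mathcal{I}_n$. Then $B(I)$ is a combinatorial $3$-ball contained in $\Delta^3_n$ that is cs-$1$-neighborly with respect to $V_n$ (i.e. its vertex set is $V_n$) and $1$-stacked; furthermore, $B(I)$ and $-B(I)$ share no common facets.
   Context: Simplicial complexes are finite abstract simplicial complexes; $\overline{A}$ is the simplex of all subsets of a finite set $A$. $V_m=\{\pm1,\dots,\pm m\}$; $-\sigma=\{ -v:v\in\sigma\}$, $-\Gamma=\{ -\sigma:\sigma\in\Gamma\}$. The join is $\Gamma*\Gamma'=\{\sigma\cup\tau\}$, $\Gamma*v:=\Gamma*\overline{\{v\}}$; a path/cycle $(v_1,\dots,v_m)$ is the 1-dimensional complex with edges $\{v_j,v_{j+1}\}$. $\partial C^*_m$ is the complex of all subsets of $V_m$ with no pair $\{j,-j\}$. For pure $\Delta$ and pure full-dimensional subcomplex $\Gamma$, $\Delta\setminus\Gamma$ is generated by facets of $\Delta$ not in $\Gamma$; $\partial B$ is the boundary of a combinatorial ball $B$. Recursive definition: $\Delta^1_n=(1,\dots,n,-1,\dots,-n,1)$; $\Delta^d_{d+1}=\partial C^*_{d+1}$; $B^{d,j}_n=\emptyset$ for $j<0$; $B^{1,0}_n=\overline{\{ -1,n\}}$; $B^{2k-1,k}_n=\Delta^{2k-1}_n\setminus B^{2k-1,k-1}_n$ ($k\ge1$, $n\ge 2k$); $B^{d,i}_n=(B^{d-1,i}_{n-1}*n)\cup((-B^{d-1,i-1}_{n-1})*(-n))$ ($d\ge2$, $n\ge d+1$, $i\le\lfloor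 d/2\rfloor$); $\Delta^d_{n+1}$ is obtained from $\Delta^d_n$ by replacing $B=B^{d,\lceil d/2\rceil-1}_n$ with $\partial B*(n+1)$ and $-B$ with $\partial(-B)*(-n-1)$. Let $\mathcal{I}_n$ be the collection of all sets $I=\{i_1<\dots<i_p\}\subseteq\{3,\dots,n-6\}$ ($p\ge0$) with $i_2-i_1>1$ if $p\ge2$; set $i_{p+1}:=n-2$. $B(I)$ is the pure 3-dimensional complex whose facets are: $\{1,2,i,i+2\}$ for $3\le i\le n-2$; $\{1,2,n-1,n\}$; $\{1,-n+2,n-1,n\}$, $\{1,-n+2,-n+1,n\}$, $\{1,-n+2,-n+1,-n\}$; $\{ -n+m+1,-n+m,n-1,n\}$ for $2\le m\le i_1$ (if $p=0$, for $2\le m\le n-2$); and for each $1\le j\le p$: $\{1,-n+i_j+2,n-i_j-1,n-i_j+1\}$ and $\{ -n+m+1,-n+m,n-i_j-1,n-i_j+1\}$ for $i_j+2\le m\le i_{j+1}$. A combinatorial $d$-ball $B$ (complex PL homeomorphic to a $d$-simplex) is $i$-stacked if every face of $B$ of dimension at most $d-i-1$ lies in $\partial B$. -}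

module Defs where

open import Data.Bool using (Bool; true; false; not; _∧_; if_then_else_)
open import Data.Nat as ℕ using (ℕ; zero; suc; _∸_; _≡ᵇ_; _≤_; _<_)
open import Data.Integer as ℤ using (ℤ; +_; ∣_∣)
open import Data.Integer.Properties using (_≟_)
open import Data.List using (List; []; _∷_; _++_; map; concatMap; filterᵇ; upTo; length; [_])
open import Data.Bool.ListAction using (any; all)
open import Data.List.Membership.Propositional using (_∈_)
open import Data.List.Relation.Unary.Any using (Any)
open import Data.List.Relation.Unary.Linked using (Linked)
open import Data.List.Relation.Unary.Unique.Propositional using (Unique)
open import Data.List.Relation.Binary.Subset.Propositional using (_⊆_)
open import Data.Product using (Σ; _×_; ∃)
open import Data.Unit using (⊤)
open import Relation.Nullary using (¬_; does)
open import Relation.Binary.PropositionalEquality using (_≡_)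

-- Simplicial complexes: a complex is represented by a finite list of
-- generating faces (its facets); vertices are integers.  A face is a
-- finite set of vertices represented by a list (set semantics:
-- membership-based inclusion).  The complex is the set of all subsets
-- of the generators.

Face : Set
Face = List ℤ

Complex : Set
Complex = List Face

IsFace : Face → Complex → Set
IsFace σ K = Any (λ F → σ ⊆ F) K

IsVertex : ℤ → Complex → Set
IsVertex v K = Any (λ F → v ∈ F) K

SameComplex : Complex → Complex → Set
SameComplex K L = (∀ σ → IsFace σ K → IsFace σ L) × (∀ σ → IsFace σ L → IsFace σ K)

_∈ᵇ_ : ℤ → Face → Bool
x ∈ᵇ ys = any (λ y → does (x ≟ y)) ys

_⊆ᵇ_ : Face → Face → Bool
xs ⊆ᵇ ys = all (λ x → x ∈ᵇ ys) xs

sameᵇ : Face → Face → Bool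
sameᵇ a b = (a ⊆ᵇ b) ∧ (b ⊆ᵇ a)

isFaceᵇ : Face → Complex → Bool
isFaceᵇ σ K = any (λ F → σ ⊆ᵇ F) K

nubC : Complex → Complex
nubC [] = []
nubC (F ∷ K) = if any (sameᵇ F) K then nubC K else F ∷ nubC K

-- Δ \ Γ : generators of Δ that are not faces of Γ
-- (for pure Δ and pure full-dimensional Γ ⊆ Δ: the facets of Δ not in Γ)
minusC : Complex → Complex → Complex
minusC Δ Γ = filterᵇ (λ F → not (isFaceᵇ F Γ)) Δ

removeV : ℤ → Face → Face
removeV x F = filterᵇ (λ y → not (does (x ≟ y))) F

ridges : Face → List Face
ridges F = map (λ x → removeV x F) F

-- boundary of a pure complex (pseudomanifold with boundary):
-- generated by the ridges contained in exactly one facet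
boundary : Complex → Complex
boundary K = filterᵇ (λ r → length (filterᵇ (λ F → r ⊆ᵇ F) K′) ≡ᵇ 1) (concatMap ridges K′)
  where
  K′ = nubC K

joinV : ℤ → Complex → Complex
joinV v K = map (λ F → v ∷ F) K

negC : Complex → Complex
negC K = map (map (λ x → ℤ.- x)) K

-- Δ^1_n = cycle (1,…,n,-1,…,-n,1)
Δ1 : ℕ → Complex
Δ1 n = map (λ j → + j ∷ + suc j ∷ []) (range1)
    ++ [ + n ∷ ℤ.- + 1 ∷ [] ]
    ++ map (λ j → ℤ.- + j ∷ ℤ.- + suc j ∷ []) (range1)
    ++ [ ℤ.- + n ∷ + 1 ∷ [] ]
  where
  range1 = map suc (upTo (n ∸ 1))

-- ∂C*_k : facets are the choices of one sign for each of 1,…,k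
crossBd : ℕ → Complex
crossBd zero = [ [] ]
crossBd (suc k) = concatMap (λ F → (+ suc k ∷ F) ∷ (ℤ.- + suc k ∷ F) ∷ []) (crossBd k)

B10 : ℕ → Complex
B10 n = [ ℤ.- + 1 ∷ + n ∷ [] ]

B11 : ℕ → Complex
B11 n = minusC (Δ1 n) (B10 n)

B20 : ℕ → Complex
B20 n = joinV (+ n) (B10 (n ∸ 1))

B21 : ℕ → Complex
B21 n = joinV (+ n) (B11 (n ∸ 1)) ++ joinV (ℤ.- + n) (negC (B10 (n ∸ 1)))

B31 : ℕ → Complex
B31 n = joinV (+ n) (B21 (n ∸ 1)) ++ joinV (ℤ.- + n) (negC (B20 (n ∸ 1)))

-- Δ^3_{n+1} from Δ^3_n, with B = B^{3,⌈3/2⌉-1}_n = B^{3,1}_n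
stepΔ3 : ℕ → Complex → Complex
stepΔ3 n Δ = minusC (minusC Δ B) (negC B)
          ++ joinV (+ suc n) (boundary B)
          ++ joinV (ℤ.- + suc n) (boundary (negC B))
  where
  B = B31 n

-- Δ3′ k = Δ^3_{4+k}
Δ3′ : ℕ → Complex
Δ3′ zero = crossBd 4
Δ3′ (suc k) = stepΔ3 (4 ℕ.+ k) (Δ3′ k)

-- Δ^3_n (meaningful for n ≥ 4)
Δ3 : ℕ → Complex
Δ3 n = Δ3′ (n ∸ 4)

range : ℕ → ℕ → List ℕ
range a b = map (λ k → a ℕ.+ k) (upTo (suc b ∸ a))

GapOK : List ℕ → Set
GapOK (a ∷ b ∷ _) = suc a < b
GapOK _ = ⊤

data AllIn (n : ℕ) : List ℕ → Set where
  []  : AllIn n []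
  _∷_ : ∀ {i is} → (3 ≤ i × i ≤ n ∸ 6) → AllIn n is → AllIn n (i ∷ is)

InI : ℕ → List ℕ → Set
InI n I = Linked _<_ I × AllIn n I × GapOK I

BI : ℕ → List ℕ → Complex
BI n I =
     map (λ i → + 1 ∷ + 2 ∷ + i ∷ + (i ℕ.+ 2) ∷ []) (range 3 (n ∸ 2))
  ++ (+ 1 ∷ + 2 ∷ N ℤ.- + 1 ∷ N ∷ [])
   ∷ (+ 1 ∷ ℤ.- N ℤ.+ + 2 ∷ N ℤ.- + 1 ∷ N ∷ [])
   ∷ (+ 1 ∷ ℤ.- N ℤ.+ + 2 ∷ ℤ.- N ℤ.+ + 1 ∷ N ∷ [])
   ∷ (+ 1 ∷ ℤ.- N ℤ.+ + 2 ∷ ℤ.- N ℤ.+ + 1 ∷ ℤ.- N ∷ [])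
   ∷ []
  ++ map (λ m → ℤ.- N ℤ.+ + suc m ∷ ℤ.- N ℤ.+ + m ∷ N ℤ.- + 1 ∷ N ∷ []) (range 2 (next I))
  ++ blocks I
  where
  N : ℤ
  N = + n
  -- i_{j+1}, with i_{p+1} = n - 2
  next : List ℕ → ℕ
  next [] = n ∸ 2
  next (b ∷ _) = b
  blocks : List ℕ → Complex
  blocks [] = []
  blocks (a ∷ rest) =
       (+ 1 ∷ ℤ.- N ℤ.+ + (a ℕ.+ 2) ∷ N ℤ.- + suc a ∷ N ℤ.- + a ℤ.+ + 1 ∷ [])
     ∷ map (λ m → ℤ.- N ℤ.+ + suc m ∷ ℤ.- N ℤ.+ + m ∷ N ℤ.- + suc a ∷ N ℤ.- + a ℤ.+ + 1 ∷ [])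
           (range (a ℕ.+ 2) (next rest))
     ++ blocks rest

-- Combinatorial balls via stellar moves (Alexander–Newman:
-- PL homeomorphism = stellar equivalence)

-- stellar subdivision of K at the face σ with a new vertex v:
-- (K minus open star of σ) ∪ (v * ∂σ * lk σ)
stellar : Face → ℤ → Complex → Complex
stellar σ v K =
     filterᵇ (λ F → not (σ ⊆ᵇ F)) K
  ++ concatMap (λ F → map (λ x → v ∷ removeV x F) σ) (filterᵇ (λ F → σ ⊆ᵇ F) K)

data StellarEq : Complex → Complex → Set where
  same    : ∀ {K L} → SameComplex K L → StellarEq K L
  subdiv  : ∀ {K} (σ : Face) (v : ℤ) → ¬ (σ ≡ []) → IsFace σ K → ¬ IsVertex v K →
            StellarEq K (stellar σ v K)
  symm    : ∀ {K L} → StellarEq K L → StellarEq L K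
  trans   : ∀ {K L M} → StellarEq K L → StellarEq L M → StellarEq K M

IsCombBall : ℕ → Complex → Set
IsCombBall d K = Σ Face λ S → Unique S × length S ≡ suc d × StellarEq K [ S ]

-- i-stacked ball: every face of dimension ≤ d - i - 1 lies in ∂B
-- (a face of dimension ≤ k is a set with at most k+1 elements)
IsStacked : ℕ → ℕ → Complex → Set
IsStacked d i B = IsCombBall d B × (∀ σ → length σ ≤ d ∸ i → IsFace σ B → IsFace σ (boundary B))

VertexSetIsV : ℕ → Complex → Set
VertexSetIsV n K = ∀ v → (IsVertex v K → ¬ (v ≡ + 0) × ∣ v ∣ ≤ n) × (¬ (v ≡ + 0) × ∣ v ∣ ≤ n → IsVertex v K)

SubComplex : Complex → Complex → Set
SubComplex K L = ∀ σ → IsFace σ K → IsFace σ L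

NoCommonFacet : Complex → Complex → Set
NoCommonFacet K L = ∀ F G → F ∈ K → G ∈ L → ¬ (F ⊆ G × G ⊆ F)

{-# OPTIONS --safe #-}
-- B(I) is built from the simplex {1, 2, n-1, n} by gluing its remaining
-- facets one at a time, each along a triangle that lies in exactly one
-- earlier facet and through a vertex not used before: first {1, 2, i, i+2}
-- for i = n-2, …, 3, then the three facets through 1 and -(n-2), then the
-- facets {-n+m+1, -n+m, n-1, n}, and finally the facets belonging to each
-- i_j.  Such a gluing is a composite of stellar moves, so B(I) is a ball;
-- and it keeps every vertex and edge inside a ridge with a single cofacet,
-- so they all lie on the boundary, which is 1-stackedness.  For B(I) ⊆ Δ^3_n
-- each facet is the cone, with apex the vertex added at some step, over a
-- boundary ridge of B^{3,1}, and it lies in no facet of a later ±B^{3,1},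
-- so it survives to Δ^3_n.

module Submission where

open import Defs
open import Data.Bool using (Bool; true; false; not; T)
open import Data.Bool.ListAction using (any)
open import Data.Empty using (⊥; ⊥-elim)
open import Data.Integer as ℤ using (ℤ; +_; -[1+_]; ∣_∣)
import Data.Integer.Properties as ℤ
open import Data.List using (List; []; _∷_; _++_; map; concatMap; filterᵇ; length; upTo; downFrom; applyUpTo; [_])
open import Data.List.Properties using (length-filter; filter-accept; filter-reject; filter-none; ++-identityʳ; ++-assoc; map-upTo)
open import Data.List.Membership.Propositional using (_∈_; _∉_; find; lose)
open import Data.List.Membership.DecPropositional ℤ._≟_ using (_∈?_)
open import Data.List.Membership.Propositional.Properties
  using (∈-filter⁺; ∈-filter⁻; ∈-++⁺ˡ; ∈-++⁺ʳ; ∈-++⁻; ∈-map⁺; ∈-map⁻; ∈-concatMap⁺; ∈-concatMap⁻; ∈-upTo⁺; ∈-upTo⁻; ∈-downFrom⁺; ∈-downFrom⁻)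
open import Data.List.Relation.Binary.Subset.Propositional using (_⊆_)
open import Data.List.Relation.Binary.Subset.Propositional.Properties using (⊆-trans)
open import Data.List.Relation.Unary.All as All using (All; []; _∷_)
open import Data.List.Relation.Unary.All.Properties using (all⁺; all⁻; ¬All⇒Any¬; All¬⇒¬Any; ++⁺)
open import Data.List.Relation.Unary.AllPairs using (AllPairs; []; _∷_)
open import Data.List.Relation.Unary.Any as Any using (Any; here; there)
open import Data.List.Relation.Unary.Any.Properties using (any⁺; any⁻)
open import Data.List.Relation.Unary.Linked as Linked using (Linked; _∷_)
open import Data.List.Relation.Unary.Unique.Propositional using (Unique)
open import Data.Nat as ℕ using (ℕ; zero; suc; _+_; _∸_; _≤_; _<_; z≤n; s≤s; _≤?_)
import Data.Nat.Properties as ℕ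
open import Data.Nat.Properties using (≡⇒≡ᵇ)
open import Data.Nat.Tactic.RingSolver using (solve-∀)
open import Data.Product using (_×_; _,_; proj₁; proj₂; ∃₂; ∃-syntax)
open import Data.Sum using (_⊎_; inj₁; inj₂)
open import Data.Unit using (⊤; tt)
open import Function using (_∘_)
open import Relation.Nullary using (¬_; Dec; yes; no; does; contradiction)
open import Relation.Nullary.Decidable using (T?; map′)
open import Relation.Binary.PropositionalEquality
  using (_≡_; _≢_; refl; sym; cong; cong₂; subst; subst₂; module ≡-Reasoning)
  renaming (trans to ≡-trans)

-- Faces, boundaries and stellar subdivisions

infix 4 _≈_

_≈_ : Face → Face → Set
F ≈ G = F ⊆ G × G ⊆ F

≈-refl : ∀ {F} → F ≈ F
≈-refl = (λ z → z) , (λ z → z)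

≈-sym : ∀ {F G} → F ≈ G → G ≈ F
≈-sym (p , q) = q , p

≈-trans : ∀ {F G H} → F ≈ G → G ≈ H → F ≈ H
≈-trans (p , q) (p′ , q′) = ⊆-trans p p′ , ⊆-trans q′ q

T-not⁺ : ∀ {b} → ¬ T b → T (not b)
T-not⁺ {false} _ = _
T-not⁺ {true} ¬t = ¬t _

T-not⁻ : ∀ {b} → T (not b) → ¬ T b
T-not⁻ {false} _ ()

≟-sound : ∀ {x y : ℤ} → T (does (x ℤ.≟ y)) → x ≡ y
≟-sound {x} {y} t with x ℤ.≟ y
... | yes x≡y = x≡y

≟-complete : ∀ {x y : ℤ} → x ≡ y → T (does (x ℤ.≟ y))
≟-complete {x} {y} x≡y with x ℤ.≟ y
... | yes _ = _
... | no x≢y = x≢y x≡y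

∈ᵇ⇒∈ : ∀ {x} ys → T (x ∈ᵇ ys) → x ∈ ys
∈ᵇ⇒∈ ys = Any.map ≟-sound ∘ any⁻ _ ys

∈⇒∈ᵇ : ∀ {x ys} → x ∈ ys → T (x ∈ᵇ ys)
∈⇒∈ᵇ = any⁺ _ ∘ Any.map ≟-complete

⊆ᵇ⇒⊆ : ∀ xs ys → T (xs ⊆ᵇ ys) → xs ⊆ ys
⊆ᵇ⇒⊆ xs ys t x∈xs = ∈ᵇ⇒∈ ys (All.lookup (all⁺ _ xs t) x∈xs)

⊆⇒⊆ᵇ : ∀ {xs ys} → xs ⊆ ys → T (xs ⊆ᵇ ys)
⊆⇒⊆ᵇ xs⊆ys = all⁻ _ (All.tabulate λ x∈xs → ∈⇒∈ᵇ (xs⊆ys x∈xs))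

IsFace⇒isFaceᵇ : ∀ {σ K} → IsFace σ K → T (isFaceᵇ σ K)
IsFace⇒isFaceᵇ = any⁺ _ ∘ Any.map ⊆⇒⊆ᵇ

isFaceᵇ⇒IsFace : ∀ σ K → T (isFaceᵇ σ K) → IsFace σ K
isFaceᵇ⇒IsFace σ K = Any.map (⊆ᵇ⇒⊆ σ _) ∘ any⁻ _ K

sameᵇ⇒≈ : ∀ F G → T (sameᵇ F G) → F ≈ G
sameᵇ⇒≈ F G t with F ⊆ᵇ G in eq
... | true = ⊆ᵇ⇒⊆ F G (subst T (sym eq) _) , ⊆ᵇ⇒⊆ G F t

≈⇒sameᵇ : ∀ {F G} → F ≈ G → T (sameᵇ F G)
≈⇒sameᵇ {F} {G} (F⊆G , G⊆F) with F ⊆ᵇ G | ⊆⇒⊆ᵇ F⊆G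
... | true | _ = ⊆⇒⊆ᵇ G⊆F

∈-filterᵇ⁺ : ∀ {A : Set} (p : A → Bool) {xs x} → x ∈ xs → T (p x) → x ∈ filterᵇ p xs
∈-filterᵇ⁺ p = ∈-filter⁺ (T? ∘ p)

∈-filterᵇ⁻ : ∀ {A : Set} (p : A → Bool) xs {x} → x ∈ filterᵇ p xs → x ∈ xs × T (p x)
∈-filterᵇ⁻ p xs = ∈-filter⁻ (T? ∘ p) {xs = xs}

IsFace-⊆ : ∀ {σ τ K} → σ ⊆ τ → IsFace τ K → IsFace σ K
IsFace-⊆ σ⊆τ τ∈K = let F , F∈K , τ⊆F = find τ∈K in lose F∈K (⊆-trans σ⊆τ τ⊆F)

refines⇒SubComplex : ∀ {K L} → (∀ {F} → F ∈ K → ∃[ G ] G ∈ L × F ⊆ G) → SubComplex K L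
refines⇒SubComplex refines σ σ∈K =
  let F , F∈K , σ⊆F = find σ∈K
      G , G∈L , F⊆G = refines F∈K
  in lose G∈L (⊆-trans σ⊆F F⊆G)

∉-vertex : ∀ {v K G} → ¬ IsVertex v K → G ∈ K → v ∉ G
∉-vertex v∉K G∈K v∈G = v∉K (lose G∈K v∈G)

∈-minusC⁻ : ∀ Δ Γ {G} → G ∈ minusC Δ Γ → G ∈ Δ × ¬ IsFace G Γ
∈-minusC⁻ Δ Γ G∈ with G∈Δ , t ← ∈-filterᵇ⁻ _ Δ G∈ = G∈Δ , T-not⁻ t ∘ IsFace⇒isFaceᵇ

∈-minusC⁺ : ∀ Δ Γ {G} → G ∈ Δ → ¬ IsFace G Γ → G ∈ minusC Δ Γ
∈-minusC⁺ Δ Γ {G} G∈Δ G∉Γ = ∈-filterᵇ⁺ _ G∈Δ (T-not⁺ (G∉Γ ∘ isFaceᵇ⇒IsFace G Γ))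

∈-removeV⁻ : ∀ x F {y} → y ∈ removeV x F → y ∈ F × x ≢ y
∈-removeV⁻ x F y∈ with y∈F , t ← ∈-filterᵇ⁻ _ F y∈ = y∈F , T-not⁻ t ∘ ≟-complete

∈-removeV⁺ : ∀ x {y F} → y ∈ F → x ≢ y → y ∈ removeV x F
∈-removeV⁺ x y∈F x≢y = ∈-filterᵇ⁺ _ y∈F (T-not⁺ (x≢y ∘ ≟-sound))

removeV-⊆ : ∀ x F → removeV x F ⊆ F
removeV-⊆ x F y∈ = proj₁ (∈-removeV⁻ x F y∈)

∉-removeV : ∀ x F → x ∉ removeV x F
∉-removeV x F x∈ = proj₂ (∈-removeV⁻ x F x∈) refl

⊆-∷-removeV : ∀ {x F} → F ⊆ x ∷ removeV x F
⊆-∷-removeV {x} {_} {y} y∈F with x ℤ.≟ y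
... | yes refl = here refl
... | no x≢y = there (∈-removeV⁺ x y∈F x≢y)

length-removeV : ∀ {x ys} → x ∈ ys → suc (length (removeV x ys)) ≤ length ys
length-removeV {x} {y ∷ ys} x∈ with x ℤ.≟ y | x∈
... | yes refl | _ = s≤s (length-filter _ ys)
... | no x≢y | here x≡y = contradiction x≡y x≢y
... | no x≢y | there x∈ys = s≤s (length-removeV x∈ys)

⊆⇒length≤ : ∀ {xs ys : Face} → Unique xs → xs ⊆ ys → length xs ≤ length ys
⊆⇒length≤ [] _ = z≤n
⊆⇒length≤ (x≢xs ∷ uniq) x∷xs⊆ys = ℕ.≤-trans
  (s≤s (⊆⇒length≤ uniq (λ y∈xs → ∈-removeV⁺ _ (x∷xs⊆ys (there y∈xs)) (All.lookup x≢xs y∈xs))))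
  (length-removeV (x∷xs⊆ys (here refl)))

_⊆?_ : (xs ys : Face) → Dec (xs ⊆ ys)
xs ⊆? ys = map′ (⊆ᵇ⇒⊆ xs ys) ⊆⇒⊆ᵇ (T? (xs ⊆ᵇ ys))

nubC-⊆ : ∀ K {F} → F ∈ nubC K → F ∈ K
nubC-⊆ (G ∷ K) F∈ with any (sameᵇ G) K | F∈
... | true  | F∈′ = there (nubC-⊆ K F∈′)
... | false | here refl = here refl
... | false | there F∈′ = there (nubC-⊆ K F∈′)

∈-nubC : ∀ K {F} → F ∈ K → ∃[ F′ ] F′ ∈ nubC K × F ≈ F′
∈-nubC (G ∷ K) F∈ with any (sameᵇ G) K in dup | F∈
... | true | here refl =
  let H , H∈K , G≈H = find (any⁻ _ K (subst T (sym dup) _))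
      F′ , F′∈ , H≈F′ = ∈-nubC K H∈K
  in F′ , F′∈ , ≈-trans (sameᵇ⇒≈ G H G≈H) H≈F′
... | true | there F∈K = ∈-nubC K F∈K
... | false | here refl = G , here refl , ≈-refl
... | false | there F∈K = let F′ , F′∈ , F≈F′ = ∈-nubC K F∈K in F′ , there F′∈ , F≈F′

nubC-distinct : ∀ K → AllPairs (λ F G → ¬ F ≈ G) (nubC K)
nubC-distinct [] = []
nubC-distinct (G ∷ K) with any (sameᵇ G) K in dup
... | true = nubC-distinct K
... | false =
  All.tabulate (λ H∈ G≈H → subst T dup (any⁺ _ (lose (nubC-⊆ K H∈) (≈⇒sameᵇ G≈H))))
  ∷ nubC-distinct K

length-cofaces≡1 : ∀ {r G₀} L → AllPairs (λ F G → ¬ F ≈ G) L → G₀ ∈ L → r ⊆ G₀ →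
                   (∀ {G} → G ∈ L → r ⊆ G → G ≈ G₀) → length (filterᵇ (λ F → r ⊆ᵇ F) L) ≡ 1
length-cofaces≡1 {r} (H ∷ L) (H≉L ∷ distinct) G₀∈ r⊆G₀ unique with r ⊆? H | G₀∈
... | yes r⊆H | _ = begin
  length (filterᵇ (λ F → r ⊆ᵇ F) (H ∷ L))  ≡⟨ cong length (filter-accept (T? ∘ (r ⊆ᵇ_)) (⊆⇒⊆ᵇ r⊆H)) ⟩
  suc (length (filterᵇ (λ F → r ⊆ᵇ F) L))  ≡⟨ cong (suc ∘ length) (filter-none (T? ∘ (r ⊆ᵇ_)) none) ⟩
  1                                         ∎
  where
  open ≡-Reasoning
  none : All (λ G → ¬ T (r ⊆ᵇ G)) L
  none = All.tabulate λ G∈ t →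
    All.lookup H≉L G∈ (≈-trans (unique (here refl) r⊆H) (≈-sym (unique (there G∈) (⊆ᵇ⇒⊆ r _ t))))
... | no r⊈H | here refl = contradiction (λ {x} → r⊆G₀ {x}) r⊈H
... | no r⊈H | there G₀∈L = begin
  length (filterᵇ (λ F → r ⊆ᵇ F) (H ∷ L))  ≡⟨ cong length (filter-reject (T? ∘ (r ⊆ᵇ_)) (r⊈H ∘ ⊆ᵇ⇒⊆ r H)) ⟩
  length (filterᵇ (λ F → r ⊆ᵇ F) L)        ≡⟨ length-cofaces≡1 L distinct G₀∈L r⊆G₀ (unique ∘ there) ⟩
  1                                         ∎
  where open ≡-Reasoning

record FreeRidge (K : Complex) (R : Face) : Set where
  field
    facet : Face
    apex : ℤ
    facet∈K : facet ∈ K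
    facet≈ : facet ≈ apex ∷ R
    apex∉R : apex ∉ R
    coface-unique : ∀ {G} → G ∈ K → R ⊆ G → G ≈ facet

-- boundary counts the cofacets of a ridge in nubC K, where no two generators
-- have the same vertex set
FreeRidge⇒boundary : ∀ {K R} → FreeRidge K R → IsFace R (boundary K)
FreeRidge⇒boundary {K} {R} free with F′ , F′∈ , (facet⊆F′ , F′⊆facet) ← ∈-nubC K (FreeRidge.facet∈K free) =
  lose (∈-filterᵇ⁺ _ r∈ridges (≡⇒≡ᵇ _ 1 single)) R⊆r
  where
  open FreeRidge free
  r = removeV apex F′
  R⊆r : R ⊆ r
  R⊆r y∈R = ∈-removeV⁺ apex (facet⊆F′ (proj₂ facet≈ (there y∈R))) λ { refl → apex∉R y∈R }
  r∈ridges : r ∈ concatMap ridges (nubC K)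
  r∈ridges = ∈-concatMap⁺ ridges (lose F′∈ (∈-map⁺ (λ x → removeV x F′) (facet⊆F′ (proj₂ facet≈ (here refl)))))
  single : length (filterᵇ (λ F → r ⊆ᵇ F) (nubC K)) ≡ 1
  single = length-cofaces≡1 (nubC K) (nubC-distinct K) F′∈ (removeV-⊆ apex F′)
             λ G∈ r⊆G → ≈-trans (coface-unique (nubC-⊆ K G∈) (⊆-trans R⊆r r⊆G)) (facet⊆F′ , F′⊆facet)

∈-stellar⁻ : ∀ σ v K {H} → H ∈ stellar σ v K →
             (H ∈ K × ¬ σ ⊆ H) ⊎ (∃₂ λ G x → G ∈ K × σ ⊆ G × x ∈ σ × H ≡ v ∷ removeV x G)
∈-stellar⁻ σ v K H∈ with ∈-++⁻ (filterᵇ (λ F → not (σ ⊆ᵇ F)) K) H∈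
... | inj₁ H∈outside = let H∈K , t = ∈-filterᵇ⁻ _ K H∈outside in inj₁ (H∈K , T-not⁻ t ∘ ⊆⇒⊆ᵇ)
... | inj₂ H∈cone =
  let G , G∈star , H∈G = find (∈-concatMap⁻ _ {xs = filterᵇ (λ F → σ ⊆ᵇ F) K} H∈cone)
      G∈K , σ⊆G = ∈-filterᵇ⁻ _ K G∈star
      x , x∈σ , H≡ = ∈-map⁻ (λ x → v ∷ removeV x G) H∈G
  in inj₂ (G , x , G∈K , ⊆ᵇ⇒⊆ σ G σ⊆G , x∈σ , H≡)

∈-stellar⁺ˡ : ∀ σ v K {H} → H ∈ K → ¬ σ ⊆ H → H ∈ stellar σ v K
∈-stellar⁺ˡ σ v K H∈K σ⊈H = ∈-++⁺ˡ (∈-filterᵇ⁺ _ H∈K (T-not⁺ (σ⊈H ∘ ⊆ᵇ⇒⊆ σ _)))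

∈-stellar⁺ʳ : ∀ σ v K {G x} → G ∈ K → σ ⊆ G → x ∈ σ → v ∷ removeV x G ∈ stellar σ v K
∈-stellar⁺ʳ σ v K {G} G∈K σ⊆G x∈σ = ∈-++⁺ʳ (filterᵇ (λ F → not (σ ⊆ᵇ F)) K)
  (∈-concatMap⁺ (λ F → map (λ x → v ∷ removeV x F) σ) (lose (∈-filterᵇ⁺ _ G∈K (⊆⇒⊆ᵇ σ⊆G)) (∈-map⁺ (λ x → v ∷ removeV x G) x∈σ)))

-- Stacking a facet onto a boundary triangle

∃∉ : ∀ {xs ys : Face} → Unique xs → length ys < length xs → ∃[ x ] x ∈ xs × x ∉ ys
∃∉ {xs} {ys} uniq ys<xs =
  find (¬All⇒Any¬ (_∈? ys) xs λ xs⊆ys → ℕ.<⇒≱ ys<xs (⊆⇒length≤ uniq (All.lookup xs⊆ys)))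

∈-snoc⁻ : ∀ {K : Complex} {F G} → G ∈ K ++ [ F ] → G ∈ K ⊎ G ≡ F
∈-snoc⁻ {K} G∈ with ∈-++⁻ K G∈
... | inj₁ G∈K = inj₁ G∈K
... | inj₂ (here G≡F) = inj₂ G≡F

-- The second fresh vertex w only serves the proof of stellar equivalence.
record Stacking (K : Complex) (F : Face) : Set where
  field
    a b c d e w : ℤ
    cofacet : Face
    cofacet∈K : cofacet ∈ K
    cofacet≈ : cofacet ≈ e ∷ a ∷ b ∷ c ∷ []
    e∉abc : e ∉ a ∷ b ∷ c ∷ []
    F≈ : F ≈ d ∷ a ∷ b ∷ c ∷ []
    d-fresh : ¬ IsVertex d K
    w-fresh : ¬ IsVertex w K
    w≢d : w ≢ d
    a≢b : a ≢ b
    a≢c : a ≢ c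
    b≢c : b ≢ c
    cofacet-unique : ∀ {G} → G ∈ K → a ∷ b ∷ c ∷ [] ⊆ G → G ≈ cofacet

-- Subdividing K at abc with d and then at the edge de with w yields the
-- same complex as subdividing K ∪ {F} at abc with w.
module StackingIsStellar {K F} (S : Stacking K F) where
  open Stacking S

  abc de : Face
  abc = a ∷ b ∷ c ∷ []
  de = d ∷ e ∷ []

  K₁ K₂ K+F L : Complex
  K₁ = stellar abc d K
  K₂ = stellar de w K₁
  K+F = K ++ [ F ]
  L = stellar abc w K+F

  abc⊆cofacet : abc ⊆ cofacet
  abc⊆cofacet x∈ = proj₂ cofacet≈ (there x∈)

  abc⊆F : abc ⊆ F
  abc⊆F x∈ = proj₂ F≈ (there x∈)

  d≢abc : ∀ {x} → x ∈ abc → d ≢ x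
  d≢abc x∈ refl = ∉-vertex d-fresh cofacet∈K (abc⊆cofacet x∈)

  e≢d : e ≢ d
  e≢d refl = ∉-vertex d-fresh cofacet∈K (proj₂ cofacet≈ (here refl))

  e∈cofacet : ∀ {G} → G ∈ K → abc ⊆ G → e ∈ G
  e∈cofacet G∈K abc⊆G = proj₂ (cofacet-unique G∈K abc⊆G) (proj₂ cofacet≈ (here refl))

  de⊆ : ∀ {G x} → G ∈ K → abc ⊆ G → x ∈ abc → de ⊆ d ∷ removeV x G
  de⊆ G∈K abc⊆G x∈ (here refl) = here refl
  de⊆ {x = x} G∈K abc⊆G x∈ (there (here refl)) =
    there (∈-removeV⁺ x (e∈cofacet G∈K abc⊆G) λ { refl → e∉abc x∈ })

  K₂⊑L : ∀ {H} → H ∈ K₂ → ∃[ H′ ] H′ ∈ L × H ⊆ H′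
  K₂⊑L {H} H∈ with ∈-stellar⁻ de w K₁ H∈
  ... | inj₁ (H∈K₁ , de⊈H) with ∈-stellar⁻ abc d K H∈K₁
  ...   | inj₁ (H∈K , abc⊈H) = H , ∈-stellar⁺ˡ abc w K+F (∈-++⁺ˡ H∈K) abc⊈H , (λ z → z)
  ...   | inj₂ (G , x , G∈K , abc⊆G , x∈ , refl) = ⊥-elim (de⊈H (de⊆ G∈K abc⊆G x∈))
  K₂⊑L H∈ | inj₂ (H₀ , y , H₀∈K₁ , de⊆H₀ , y∈de , refl) with ∈-stellar⁻ abc d K H₀∈K₁
  ... | inj₁ (H₀∈K , _) = ⊥-elim (∉-vertex d-fresh H₀∈K (de⊆H₀ (here refl)))
  ... | inj₂ (G , x , G∈K , abc⊆G , x∈ , refl) with y∈de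
  ...   | here refl = w ∷ removeV x G , ∈-stellar⁺ʳ abc w K+F (∈-++⁺ˡ G∈K) abc⊆G x∈ , sub
    where
    sub : w ∷ removeV d (d ∷ removeV x G) ⊆ w ∷ removeV x G
    sub (here refl) = here refl
    sub (there z∈) with ∈-removeV⁻ d (d ∷ removeV x G) z∈
    ... | here refl , d≢d = ⊥-elim (d≢d refl)
    ... | there z∈′ , _ = there z∈′
  ...   | there (here refl) = w ∷ removeV x F , ∈-stellar⁺ʳ abc w K+F (∈-++⁺ʳ K (here refl)) abc⊆F x∈ , sub
    where
    sub : w ∷ removeV e (d ∷ removeV x G) ⊆ w ∷ removeV x F
    sub (here refl) = here refl
    sub (there z∈) with ∈-removeV⁻ e (d ∷ removeV x G) z∈
    ... | here refl , _ = there (∈-removeV⁺ x (proj₂ F≈ (here refl)) (λ x≡d → d≢abc x∈ (sym x≡d)))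
    ... | there z∈′ , e≢z with ∈-removeV⁻ x G z∈′
    ...   | z∈G , x≢z with proj₁ cofacet≈ (proj₁ (cofacet-unique G∈K abc⊆G) z∈G)
    ...     | here refl = ⊥-elim (e≢z refl)
    ...     | there z∈abc = there (∈-removeV⁺ x (abc⊆F z∈abc) x≢z)

  L⊑K₂ : ∀ {H} → H ∈ L → ∃[ H′ ] H′ ∈ K₂ × H ⊆ H′
  L⊑K₂ {H} H∈ with ∈-stellar⁻ abc w K+F H∈
  ... | inj₁ (H∈K+F , abc⊈H) with ∈-snoc⁻ {K} H∈K+F
  ...   | inj₂ refl = ⊥-elim (abc⊈H abc⊆F)
  ...   | inj₁ H∈K = H , ∈-stellar⁺ˡ de w K₁ (∈-stellar⁺ˡ abc d K H∈K abc⊈H)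
                           (λ de⊆H → ∉-vertex d-fresh H∈K (de⊆H (here refl))) , (λ z → z)
  L⊑K₂ H∈ | inj₂ (G , x , G∈K+F , abc⊆G , x∈ , refl) with ∈-snoc⁻ {K} G∈K+F
  ... | inj₁ G∈K = w ∷ removeV d (d ∷ removeV x G) ,
        ∈-stellar⁺ʳ de w K₁ (∈-stellar⁺ʳ abc d K G∈K abc⊆G x∈) (de⊆ G∈K abc⊆G x∈) (here refl) , sub
    where
    sub : w ∷ removeV x G ⊆ w ∷ removeV d (d ∷ removeV x G)
    sub (here refl) = here refl
    sub (there z∈) = there (∈-removeV⁺ d (there z∈)
      λ { refl → ∉-vertex d-fresh G∈K (removeV-⊆ x G z∈) })
  ... | inj₂ refl = w ∷ removeV e (d ∷ removeV x cofacet) ,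
        ∈-stellar⁺ʳ de w K₁ (∈-stellar⁺ʳ abc d K cofacet∈K abc⊆cofacet x∈) (de⊆ cofacet∈K abc⊆cofacet x∈) (there (here refl)) , sub
    where
    sub : w ∷ removeV x F ⊆ w ∷ removeV e (d ∷ removeV x cofacet)
    sub (here refl) = here refl
    sub (there z∈) with ∈-removeV⁻ x F z∈
    ... | z∈F , x≢z with proj₁ F≈ z∈F
    ...   | here refl = there (∈-removeV⁺ e (here refl) e≢d)
    ...   | there z∈abc = there (∈-removeV⁺ e (there (∈-removeV⁺ x (abc⊆cofacet z∈abc) x≢z))
                                           λ { refl → e∉abc z∈abc })

  w-fresh₁ : ¬ IsVertex w K₁
  w-fresh₁ w∈K₁ with H , H∈ , w∈H ← find w∈K₁ with ∈-stellar⁻ abc d K H∈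
  ... | inj₁ (H∈K , _) = ∉-vertex w-fresh H∈K w∈H
  ... | inj₂ (G , x , G∈K , _ , _ , refl) with w∈H
  ...   | here w≡d = w≢d w≡d
  ...   | there w∈ = ∉-vertex w-fresh G∈K (removeV-⊆ x G w∈)

  w-fresh₂ : ¬ IsVertex w K+F
  w-fresh₂ w∈K+F with H , H∈ , w∈H ← find w∈K+F with ∈-snoc⁻ {K} H∈
  ... | inj₁ H∈K = ∉-vertex w-fresh H∈K w∈H
  ... | inj₂ refl with proj₁ F≈ w∈H
  ...   | here w≡d = w≢d w≡d
  ...   | there w∈abc = ∉-vertex w-fresh cofacet∈K (abc⊆cofacet w∈abc)

  stellarEq : StellarEq K K+F
  stellarEq =
    trans (subdiv abc d (λ ()) (lose cofacet∈K abc⊆cofacet) d-fresh)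
    (trans (subdiv de w (λ ()) (lose (∈-stellar⁺ʳ abc d K cofacet∈K abc⊆cofacet (here refl)) (de⊆ cofacet∈K abc⊆cofacet (here refl))) w-fresh₁)
    (trans (same (refines⇒SubComplex K₂⊑L , refines⇒SubComplex L⊑K₂))
           (symm (subdiv abc w (λ ()) (lose (∈-++⁺ˡ cofacet∈K) abc⊆cofacet) w-fresh₂))))

Stacking⇒StellarEq : ∀ {K F} → Stacking K F → StellarEq K (K ++ [ F ])
Stacking⇒StellarEq S = StackingIsStellar.stellarEq S

EdgesOnFreeRidges : Complex → Set
EdgesOnFreeRidges K = ∀ σ → length σ ≤ 2 → IsFace σ K → ∃[ R ] FreeRidge K R × σ ⊆ R

freeRidge-removeV : ∀ {K F y} → F ∈ K → y ∈ F →
                    (∀ {G} → G ∈ K → removeV y F ⊆ G → G ≈ F) → FreeRidge K (removeV y F)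
freeRidge-removeV {F = F} {y} F∈K y∈F unique = record
  { facet = F ; apex = y ; facet∈K = F∈K
  ; facet≈ = ⊆-∷-removeV , λ { (here refl) → y∈F ; (there z∈) → removeV-⊆ y F z∈ }
  ; apex∉R = ∉-removeV y F ; coface-unique = unique }

module _ {K F} (S : Stacking K F) where
  open Stacking S

  -- A small face of F avoids one of a, b, c; the ridge of F opposite to it
  -- contains the new vertex d, so F is its only coface.
  private
    freeRidge-new : ∀ {σ} → length σ ≤ 2 → σ ⊆ F → ∃[ R ] FreeRidge (K ++ [ F ]) R × σ ⊆ R
    freeRidge-new σ≤2 σ⊆F with ∃∉ {a ∷ b ∷ c ∷ []} ((a≢b ∷ a≢c ∷ []) ∷ (b≢c ∷ []) ∷ [] ∷ []) (s≤s σ≤2)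
    ... | y , y∈abc , y∉σ = removeV y F , freeRidge-removeV (∈-++⁺ʳ K (here refl)) y∈F unique′ ,
                            λ z∈σ → ∈-removeV⁺ y (σ⊆F z∈σ) λ { refl → y∉σ z∈σ }
      where
      y∈F = proj₂ F≈ (there y∈abc)
      d∈R : d ∈ removeV y F
      d∈R = ∈-removeV⁺ y (proj₂ F≈ (here refl))
              λ { refl → ∉-vertex d-fresh cofacet∈K (proj₂ cofacet≈ (there y∈abc)) }
      unique′ : ∀ {G} → G ∈ K ++ [ F ] → removeV y F ⊆ G → G ≈ F
      unique′ G∈ R⊆G with ∈-snoc⁻ {K} G∈
      ... | inj₁ G∈K = ⊥-elim (∉-vertex d-fresh G∈K (R⊆G d∈R))
      ... | inj₂ refl = ≈-refl

    freeRidge-old : ∀ {R} → FreeRidge K R → ¬ R ⊆ F → FreeRidge (K ++ [ F ]) R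
    freeRidge-old {R} free R⊈F = record
      { facet = facet ; apex = apex ; facet∈K = ∈-++⁺ˡ facet∈K ; facet≈ = facet≈ ; apex∉R = apex∉R
      ; coface-unique = unique′ }
      where
      open FreeRidge free
      unique′ : ∀ {G} → G ∈ K ++ [ F ] → R ⊆ G → G ≈ facet
      unique′ G∈ R⊆G with ∈-snoc⁻ {K} G∈
      ... | inj₁ G∈K = coface-unique G∈K R⊆G
      ... | inj₂ refl = ⊥-elim (R⊈F R⊆G)

  Stacking-preserves-EdgesOnFreeRidges : EdgesOnFreeRidges K → EdgesOnFreeRidges (K ++ [ F ])
  Stacking-preserves-EdgesOnFreeRidges onFree σ σ≤2 σ∈K+F with find σ∈K+F
  ... | H , H∈ , σ⊆H with ∈-snoc⁻ {K} H∈
  ...   | inj₂ refl = freeRidge-new σ≤2 σ⊆H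
  ...   | inj₁ H∈K with onFree σ σ≤2 (lose H∈K σ⊆H)
  ...     | R , free , σ⊆R with R ⊆? F
  ...       | yes R⊆F = freeRidge-new σ≤2 (⊆-trans σ⊆R R⊆F)
  ...       | no R⊈F = R , freeRidge-old free R⊈F , σ⊆R

StackingSequence : Complex → List Face → Set
StackingSequence K [] = ⊤
StackingSequence K (F ∷ Fs) = Stacking K F × StackingSequence (K ++ [ F ]) Fs

StackingSequence-++ : ∀ K Fs {Gs} → StackingSequence K Fs → StackingSequence (K ++ Fs) Gs →
                      StackingSequence K (Fs ++ Gs)
StackingSequence-++ K [] {Gs} _ seq = subst (λ L → StackingSequence L Gs) (++-identityʳ K) seq
StackingSequence-++ K (F ∷ Fs) {Gs} (S , seq₁) seq₂ =
  S , StackingSequence-++ (K ++ [ F ]) Fs seq₁ (subst (λ L → StackingSequence L Gs) (sym (++-assoc K [ F ] Fs)) seq₂)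

StackingSequence⇒StellarEq : ∀ K Fs → StackingSequence K Fs → StellarEq K (K ++ Fs)
StackingSequence⇒StellarEq K [] _ = same (subst (SameComplex K) (sym (++-identityʳ K)) ((λ _ z → z) , (λ _ z → z)))
StackingSequence⇒StellarEq K (F ∷ Fs) (S , seq) =
  trans (Stacking⇒StellarEq S)
        (subst (StellarEq (K ++ [ F ])) (++-assoc K [ F ] Fs) (StackingSequence⇒StellarEq (K ++ [ F ]) Fs seq))

StackingSequence-preserves-EdgesOnFreeRidges : ∀ K Fs → StackingSequence K Fs →
                                               EdgesOnFreeRidges K → EdgesOnFreeRidges (K ++ Fs)
StackingSequence-preserves-EdgesOnFreeRidges K [] _ onFree = subst EdgesOnFreeRidges (sym (++-identityʳ K)) onFree
StackingSequence-preserves-EdgesOnFreeRidges K (F ∷ Fs) (S , seq) onFree =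
  subst EdgesOnFreeRidges (++-assoc K [ F ] Fs)
    (StackingSequence-preserves-EdgesOnFreeRidges (K ++ [ F ]) Fs seq (Stacking-preserves-EdgesOnFreeRidges S onFree))

simplex-EdgesOnFreeRidges : ∀ {S} → Unique S → length S ≡ 4 → EdgesOnFreeRidges [ S ]
simplex-EdgesOnFreeRidges {S} uniq len≡4 σ σ≤2 (here σ⊆S)
  with ∃∉ uniq (subst (length σ <_) (sym len≡4) (s≤s (ℕ.m≤n⇒m≤1+n σ≤2)))
... | y , y∈S , y∉σ = removeV y S , freeRidge-removeV (here refl) y∈S (λ { (here refl) _ → ≈-refl }) ,
                      λ z∈σ → ∈-removeV⁺ y (σ⊆S z∈σ) λ { refl → y∉σ z∈σ }

FreeRidge-resp-∈ : ∀ {K L R} → (∀ {F} → F ∈ K → F ∈ L) → (∀ {F} → F ∈ L → F ∈ K) →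
                   FreeRidge K R → FreeRidge L R
FreeRidge-resp-∈ K⊆L L⊆K free = record
  { facet = facet ; apex = apex ; facet∈K = K⊆L facet∈K ; facet≈ = facet≈ ; apex∉R = apex∉R
  ; coface-unique = λ G∈L R⊆G → coface-unique (L⊆K G∈L) R⊆G }
  where open FreeRidge free

StackingSequence⇒IsStacked : ∀ {S Fs B} → Unique S → length S ≡ 4 → StackingSequence [ S ] Fs →
              (∀ {F} → F ∈ S ∷ Fs → F ∈ B) → (∀ {F} → F ∈ B → F ∈ S ∷ Fs) → IsStacked 3 1 B
StackingSequence⇒IsStacked {S} {Fs} {B} uniq len seq ⊆B B⊆ = ball , onBoundary
  where
  ball : IsCombBall 3 B
  ball = S , uniq , len ,
    symm (trans (StackingSequence⇒StellarEq [ S ] Fs seq)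
                (same (refines⇒SubComplex (λ F∈ → _ , ⊆B F∈ , λ z → z) , refines⇒SubComplex (λ F∈ → _ , B⊆ F∈ , λ z → z))))
  onBoundary : ∀ σ → length σ ≤ 2 → IsFace σ B → IsFace σ (boundary B)
  onBoundary σ σ≤2 σ∈B with StackingSequence-preserves-EdgesOnFreeRidges [ S ] Fs seq
                              (simplex-EdgesOnFreeRidges uniq len) σ σ≤2 (refines⇒SubComplex (λ F∈ → _ , B⊆ F∈ , λ z → z) σ σ∈B)
  ... | R , free , σ⊆R = IsFace-⊆ σ⊆R (FreeRidge⇒boundary (FreeRidge-resp-∈ ⊆B B⊆ free))

-- The boundary of B^{3,1} and the faces of Δ^3_n

∉⁴ : ∀ {x a b c d : ℤ} → x ≢ a → x ≢ b → x ≢ c → x ≢ d → x ∉ a ∷ b ∷ c ∷ d ∷ []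
∉⁴ p q r s = All¬⇒¬Any (p ∷ q ∷ r ∷ s ∷ [])

≈-bring : ∀ xs {y : ℤ} {ys} → xs ++ y ∷ ys ≈ y ∷ xs ++ ys
≈-bring xs {y} {ys} = to , from
  where
  to : xs ++ y ∷ ys ⊆ y ∷ xs ++ ys
  to z∈ with ∈-++⁻ xs z∈
  ... | inj₁ z∈xs = there (∈-++⁺ˡ z∈xs)
  ... | inj₂ (here refl) = here refl
  ... | inj₂ (there z∈ys) = there (∈-++⁺ʳ xs z∈ys)
  from : y ∷ xs ++ ys ⊆ xs ++ y ∷ ys
  from (here refl) = ∈-++⁺ʳ xs (here refl)
  from (there z∈) with ∈-++⁻ xs z∈
  ... | inj₁ z∈xs = ∈-++⁺ˡ z∈xs
  ... | inj₂ z∈ys = ∈-++⁺ʳ xs (there z∈ys)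

freeRidge-split : ∀ {K} xs {y ys} → xs ++ y ∷ ys ∈ K → y ∉ xs ++ ys →
                  (∀ {G} → G ∈ K → xs ++ ys ⊆ G → G ≈ xs ++ y ∷ ys) → FreeRidge K (xs ++ ys)
freeRidge-split xs F∈K y∉R unique = record
  { facet = _ ; apex = _ ; facet∈K = F∈K ; facet≈ = ≈-bring xs ; apex∉R = y∉R ; coface-unique = unique }

data Δ1Edge (j : ℕ) : Face → Set where
  pos  : ∀ x → x < suc j → Δ1Edge j (+ suc x ∷ + (2 + x) ∷ [])
  neg  : ∀ x → x < suc j → Δ1Edge j (-[1+ x ] ∷ -[1+ suc x ] ∷ [])
  link : Δ1Edge j (+ (2 + j) ∷ -[1+ 0 ] ∷ [])
  wrap : Δ1Edge j (-[1+ suc j ] ∷ + 1 ∷ [])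

private
  posEdges negEdges : ℕ → Complex
  posEdges j = map (λ i → + i ∷ + suc i ∷ []) (map suc (upTo (suc j)))
  negEdges j = map (λ i → ℤ.- (+ i) ∷ ℤ.- (+ suc i) ∷ []) (map suc (upTo (suc j)))

∈-Δ1⁻ : ∀ j {E} → E ∈ Δ1 (2 + j) → Δ1Edge j E
∈-Δ1⁻ j E∈ with ∈-++⁻ (posEdges j) E∈
... | inj₁ E∈pos with _ , i∈ , refl ← ∈-map⁻ _ E∈pos with x , x∈ , refl ← ∈-map⁻ suc i∈ = pos x (∈-upTo⁻ x∈)
... | inj₂ (here refl) = link
... | inj₂ (there E∈′) with ∈-++⁻ (negEdges j) E∈′
...   | inj₁ E∈neg with _ , i∈ , refl ← ∈-map⁻ _ E∈neg with x , x∈ , refl ← ∈-map⁻ suc i∈ = neg x (∈-upTo⁻ x∈)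
...   | inj₂ (here refl) = wrap

∈-Δ1⁺ : ∀ j {E} → Δ1Edge j E → E ∈ Δ1 (2 + j)
∈-Δ1⁺ j (pos x x<) = ∈-++⁺ˡ (∈-map⁺ _ (∈-map⁺ suc (∈-upTo⁺ x<)))
∈-Δ1⁺ j link = ∈-++⁺ʳ (posEdges j) (here refl)
∈-Δ1⁺ j (neg x x<) = ∈-++⁺ʳ (posEdges j) (there (∈-++⁺ˡ (∈-map⁺ _ (∈-map⁺ suc (∈-upTo⁺ x<)))))
∈-Δ1⁺ j wrap = ∈-++⁺ʳ (posEdges j) (there (∈-++⁺ʳ (negEdges j) (here refl)))

∈-B11⁻ : ∀ j {E} → E ∈ B11 (2 + j) → Δ1Edge j E × ¬ E ≡ + (2 + j) ∷ -[1+ 0 ] ∷ []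
∈-B11⁻ j E∈ with E∈Δ1 , E∉B10 ← ∈-minusC⁻ (Δ1 (2 + j)) (B10 (2 + j)) E∈ with ∈-Δ1⁻ j E∈Δ1
... | link = ⊥-elim (E∉B10 (here λ { (here refl) → there (here refl) ; (there (here refl)) → here refl }))
... | pos x x< = pos x x< , λ ()
... | neg x x< = neg x x< , λ ()
... | wrap = wrap , λ ()

∈-B11⁺ : ∀ j {E} → Δ1Edge j E → ¬ E ⊆ -[1+ 0 ] ∷ + (2 + j) ∷ [] → E ∈ B11 (2 + j)
∈-B11⁺ j e E⊈ = ∈-minusC⁺ (Δ1 (2 + j)) (B10 (2 + j)) (∈-Δ1⁺ j e) λ { (here E⊆) → E⊈ E⊆ }

data B31Facet (j : ℕ) : Face → Set where
  pos   : ∀ x → x < suc j → B31Facet j (+ (4 + j) ∷ + (3 + j) ∷ + suc x ∷ + (2 + x) ∷ [])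
  neg   : ∀ x → x < suc j → B31Facet j (+ (4 + j) ∷ + (3 + j) ∷ -[1+ x ] ∷ -[1+ suc x ] ∷ [])
  wrap  : B31Facet j (+ (4 + j) ∷ + (3 + j) ∷ -[1+ suc j ] ∷ + 1 ∷ [])
  cone⁺ : B31Facet j (+ (4 + j) ∷ -[1+ 2 + j ] ∷ + 1 ∷ -[1+ suc j ] ∷ [])
  cone⁻ : B31Facet j (-[1+ 3 + j ] ∷ -[1+ 2 + j ] ∷ + 1 ∷ -[1+ suc j ] ∷ [])

∈-B31⁻ : ∀ j {H} → H ∈ B31 (4 + j) → B31Facet j H
∈-B31⁻ j H∈ with ∈-++⁻ (joinV (+ (4 + j)) (B21 (3 + j))) H∈
... | inj₂ (here refl) = cone⁻
... | inj₁ H∈⁺ with _ , H′∈ , refl ← ∈-map⁻ _ H∈⁺ with ∈-++⁻ (joinV (+ (3 + j)) (B11 (2 + j))) H′∈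
...   | inj₂ (here refl) = cone⁺
...   | inj₁ H″∈ with _ , E∈ , refl ← ∈-map⁻ _ H″∈ with ∈-B11⁻ j E∈
...     | pos x x< , _ = pos x x<
...     | neg x x< , _ = neg x x<
...     | wrap , _ = wrap
...     | link , not-link = ⊥-elim (not-link refl)

∈-B31⁺ : ∀ j {H} → B31Facet j H → H ∈ B31 (4 + j)
∈-B31⁺ j (pos x x<) = ∈-++⁺ˡ (∈-map⁺ _ (∈-++⁺ˡ (∈-map⁺ _ (∈-B11⁺ j (pos x x<) λ E⊆ → x+1∉ (E⊆ (here refl))))))
  where
  x+1∉ : + suc x ∉ -[1+ 0 ] ∷ + (2 + j) ∷ []
  x+1∉ (there (here refl)) = ℕ.<-irrefl refl x<
∈-B31⁺ j (neg x x<) = ∈-++⁺ˡ (∈-map⁺ _ (∈-++⁺ˡ (∈-map⁺ _ (∈-B11⁺ j (neg x x<) λ E⊆ →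
  All¬⇒¬Any ((λ ()) ∷ (λ ()) ∷ []) (E⊆ (there (here refl)))))))
∈-B31⁺ j wrap = ∈-++⁺ˡ (∈-map⁺ _ (∈-++⁺ˡ (∈-map⁺ _ (∈-B11⁺ j wrap λ E⊆ →
  All¬⇒¬Any ((λ ()) ∷ (λ ()) ∷ []) (E⊆ (there (here refl)))))))
∈-B31⁺ j cone⁺ = ∈-++⁺ˡ (∈-map⁺ _ (∈-++⁺ʳ (joinV (+ (3 + j)) (B11 (2 + j))) (here refl)))
∈-B31⁺ j cone⁻ = ∈-++⁺ʳ (joinV (+ (4 + j)) (B21 (3 + j))) (here refl)

∉³ : ∀ {x a b c : ℤ} → x ≢ a → x ≢ b → x ≢ c → x ∉ a ∷ b ∷ c ∷ []
∉³ p q r = All¬⇒¬Any (p ∷ q ∷ r ∷ [])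

module B31Ridges (j : ℕ) where
  private
    K = B31 (4 + j)
    P4 = + (4 + j)
    P3 = + (3 + j)

    ≮-suc : ∀ {x} → ¬ suc (suc x) < suc x
    ≮-suc x< = ℕ.<-asym x< (ℕ.n<1+n _)

  ridge-12 : FreeRidge K (P3 ∷ + 1 ∷ + 2 ∷ [])
  ridge-12 = freeRidge-split [] (∈-B31⁺ j (pos 0 (s≤s z≤n))) (∉³ (λ ()) (λ ()) (λ ())) unique
    where
    unique : ∀ {G} → G ∈ K → P3 ∷ + 1 ∷ + 2 ∷ [] ⊆ G → G ≈ P4 ∷ P3 ∷ + 1 ∷ + 2 ∷ []
    unique G∈ R⊆G with ∈-B31⁻ j G∈ | R⊆G (there (here refl)) | R⊆G (there (there (here refl)))
    ... | pos _ _ | there (there (here refl)) | _ = ≈-refl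
    ... | pos _ _ | there (there (there (here ()))) | _
    ... | neg _ _ | 1∈ | _ = ⊥-elim (∉⁴ (λ ()) (λ ()) (λ ()) (λ ()) 1∈)
    ... | wrap | _ | 2∈ = ⊥-elim (∉⁴ (λ ()) (λ ()) (λ ()) (λ ()) 2∈)
    ... | cone⁺ | _ | 2∈ = ⊥-elim (∉⁴ (λ ()) (λ ()) (λ ()) (λ ()) 2∈)
    ... | cone⁻ | _ | 2∈ = ⊥-elim (∉⁴ (λ ()) (λ ()) (λ ()) (λ ()) 2∈)

  ridge-n12 : FreeRidge K (P4 ∷ + 1 ∷ + 2 ∷ [])
  ridge-n12 = freeRidge-split (P4 ∷ []) (∈-B31⁺ j (pos 0 (s≤s z≤n))) (∉³ (λ ()) (λ ()) (λ ())) unique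
    where
    unique : ∀ {G} → G ∈ K → P4 ∷ + 1 ∷ + 2 ∷ [] ⊆ G → G ≈ P4 ∷ P3 ∷ + 1 ∷ + 2 ∷ []
    unique G∈ R⊆G with ∈-B31⁻ j G∈ | R⊆G (there (here refl)) | R⊆G (there (there (here refl)))
    ... | pos _ _ | there (there (here refl)) | _ = ≈-refl
    ... | pos _ _ | there (there (there (here ()))) | _
    ... | neg _ _ | 1∈ | _ = ⊥-elim (∉⁴ (λ ()) (λ ()) (λ ()) (λ ()) 1∈)
    ... | wrap | _ | 2∈ = ⊥-elim (∉⁴ (λ ()) (λ ()) (λ ()) (λ ()) 2∈)
    ... | cone⁺ | _ | 2∈ = ⊥-elim (∉⁴ (λ ()) (λ ()) (λ ()) (λ ()) 2∈)
    ... | cone⁻ | _ | 2∈ = ⊥-elim (∉⁴ (λ ()) (λ ()) (λ ()) (λ ()) 2∈)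

  ridge-cone⁺ : FreeRidge K (P4 ∷ -[1+ 2 + j ] ∷ + 1 ∷ [])
  ridge-cone⁺ = freeRidge-split (P4 ∷ -[1+ 2 + j ] ∷ + 1 ∷ []) (∈-B31⁺ j cone⁺) (∉³ (λ ()) (λ ()) (λ ())) unique
    where
    unique : ∀ {G} → G ∈ K → P4 ∷ -[1+ 2 + j ] ∷ + 1 ∷ [] ⊆ G → G ≈ P4 ∷ -[1+ 2 + j ] ∷ + 1 ∷ -[1+ suc j ] ∷ []
    unique G∈ R⊆G with ∈-B31⁻ j G∈
    ... | pos _ _ = ⊥-elim (∉⁴ (λ ()) (λ ()) (λ ()) (λ ()) (R⊆G (there (here refl))))
    ... | neg _ _ = ⊥-elim (∉⁴ (λ ()) (λ ()) (λ ()) (λ ()) (R⊆G (there (there (here refl)))))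
    ... | wrap = ⊥-elim (∉⁴ (λ ()) (λ ()) (λ ()) (λ ()) (R⊆G (there (here refl))))
    ... | cone⁺ = ≈-refl
    ... | cone⁻ = ⊥-elim (∉⁴ (λ ()) (λ ()) (λ ()) (λ ()) (R⊆G (here refl)))

  ridge-cone⁻ : FreeRidge K (-[1+ 3 + j ] ∷ -[1+ 2 + j ] ∷ + 1 ∷ [])
  ridge-cone⁻ = freeRidge-split (-[1+ 3 + j ] ∷ -[1+ 2 + j ] ∷ + 1 ∷ []) (∈-B31⁺ j cone⁻) (∉³ (λ ()) (λ ()) (λ ())) unique
    where
    unique : ∀ {G} → G ∈ K → -[1+ 3 + j ] ∷ -[1+ 2 + j ] ∷ + 1 ∷ [] ⊆ G →
             G ≈ -[1+ 3 + j ] ∷ -[1+ 2 + j ] ∷ + 1 ∷ -[1+ suc j ] ∷ []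
    unique G∈ R⊆G with ∈-B31⁻ j G∈
    ... | pos _ _ = ⊥-elim (∉⁴ (λ ()) (λ ()) (λ ()) (λ ()) (R⊆G (here refl)))
    ... | neg _ _ = ⊥-elim (∉⁴ (λ ()) (λ ()) (λ ()) (λ ()) (R⊆G (there (there (here refl)))))
    ... | wrap = ⊥-elim (∉⁴ (λ ()) (λ ()) (λ ()) (λ ()) (R⊆G (here refl)))
    ... | cone⁺ = ⊥-elim (∉⁴ (λ ()) (λ ()) (λ ()) (λ ()) (R⊆G (here refl)))
    ... | cone⁻ = ≈-refl

  ridge-neg-cone⁻ : FreeRidge (negC K) (-[1+ 3 + j ] ∷ -[1+ 2 + j ] ∷ + 1 ∷ [])
  ridge-neg-cone⁻ = freeRidge-split (-[1+ 3 + j ] ∷ -[1+ 2 + j ] ∷ + 1 ∷ [])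
    (∈-map⁺ (map (λ x → ℤ.- x)) (∈-B31⁺ j (neg 0 (s≤s z≤n)))) (∉³ (λ ()) (λ ()) (λ ())) unique
    where
    unique : ∀ {G} → G ∈ negC K → -[1+ 3 + j ] ∷ -[1+ 2 + j ] ∷ + 1 ∷ [] ⊆ G →
             G ≈ -[1+ 3 + j ] ∷ -[1+ 2 + j ] ∷ + 1 ∷ + 2 ∷ []
    unique G∈ R⊆G with G₀ , G₀∈ , refl ← ∈-map⁻ (map (λ x → ℤ.- x)) G∈ = unique₀ (∈-B31⁻ j G₀∈) R⊆G
      where
      unique₀ : ∀ {G₀} → B31Facet j G₀ → -[1+ 3 + j ] ∷ -[1+ 2 + j ] ∷ + 1 ∷ [] ⊆ map (λ x → ℤ.- x) G₀ →
                map (λ x → ℤ.- x) G₀ ≈ -[1+ 3 + j ] ∷ -[1+ 2 + j ] ∷ + 1 ∷ + 2 ∷ []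
      unique₀ (pos _ _) R⊆G = ⊥-elim (∉⁴ (λ ()) (λ ()) (λ ()) (λ ()) (R⊆G (there (there (here refl)))))
      unique₀ (neg _ _) R⊆G with R⊆G (there (there (here refl)))
      ... | there (there (here refl)) = ≈-refl
      ... | there (there (there (here ())))
      unique₀ wrap R⊆G = ⊥-elim (∉⁴ (λ ()) (λ ()) (λ ()) (λ ()) (R⊆G (there (there (here refl)))))
      unique₀ cone⁺ R⊆G = ⊥-elim (∉⁴ (λ ()) (λ ()) (λ ()) (λ ()) (R⊆G (there (here refl))))
      unique₀ cone⁻ R⊆G = ⊥-elim (∉⁴ (λ ()) (λ ()) (λ ()) (λ ()) (R⊆G (there (here refl))))

  ridge-cone⁺-base : FreeRidge K (P4 ∷ -[1+ 2 + j ] ∷ -[1+ suc j ] ∷ [])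
  ridge-cone⁺-base = freeRidge-split (P4 ∷ -[1+ 2 + j ] ∷ []) (∈-B31⁺ j cone⁺) (∉³ (λ ()) (λ ()) (λ ())) unique
    where
    unique : ∀ {G} → G ∈ K → P4 ∷ -[1+ 2 + j ] ∷ -[1+ suc j ] ∷ [] ⊆ G →
             G ≈ P4 ∷ -[1+ 2 + j ] ∷ + 1 ∷ -[1+ suc j ] ∷ []
    unique G∈ R⊆G with ∈-B31⁻ j G∈
    ... | pos _ _ = ⊥-elim (∉⁴ (λ ()) (λ ()) (λ ()) (λ ()) (R⊆G (there (here refl))))
    ... | neg _ x< with R⊆G (there (here refl))
    ...   | there (there (here refl)) = ⊥-elim (≮-suc x<)
    ...   | there (there (there (here refl))) = ⊥-elim (ℕ.<-irrefl refl x<)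
    unique G∈ R⊆G | wrap = ⊥-elim (∉⁴ (λ ()) (λ ()) (λ ()) (λ ()) (R⊆G (there (here refl))))
    unique G∈ R⊆G | cone⁺ = ≈-refl
    unique G∈ R⊆G | cone⁻ = ⊥-elim (∉⁴ (λ ()) (λ ()) (λ ()) (λ ()) (R⊆G (here refl)))

  ridge-wrap : FreeRidge K (P3 ∷ -[1+ suc j ] ∷ + 1 ∷ [])
  ridge-wrap = freeRidge-split [] (∈-B31⁺ j wrap) (∉³ (λ ()) (λ ()) (λ ())) unique
    where
    unique : ∀ {G} → G ∈ K → P3 ∷ -[1+ suc j ] ∷ + 1 ∷ [] ⊆ G → G ≈ P4 ∷ P3 ∷ -[1+ suc j ] ∷ + 1 ∷ []
    unique G∈ R⊆G with ∈-B31⁻ j G∈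
    ... | pos _ _ = ⊥-elim (∉⁴ (λ ()) (λ ()) (λ ()) (λ ()) (R⊆G (there (here refl))))
    ... | neg _ _ = ⊥-elim (∉⁴ (λ ()) (λ ()) (λ ()) (λ ()) (R⊆G (there (there (here refl)))))
    ... | wrap = ≈-refl
    ... | cone⁺ = ⊥-elim (∉⁴ (λ ()) (λ ()) (λ ()) (λ ()) (R⊆G (here refl)))
    ... | cone⁻ = ⊥-elim (∉⁴ (λ ()) (λ ()) (λ ()) (λ ()) (R⊆G (here refl)))

  private
    neg-cofacet : ∀ {s G} q → s < suc j → B31Facet j G → -[1+ s ] ∷ -[1+ suc s ] ∷ q ∷ [] ⊆ G →
                  (G ≡ P4 ∷ P3 ∷ -[1+ s ] ∷ -[1+ suc s ] ∷ []) ⊎ (G ≡ P4 ∷ -[1+ 2 + j ] ∷ + 1 ∷ -[1+ suc j ] ∷ [])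
    neg-cofacet q s< (pos _ _) R⊆G = ⊥-elim (∉⁴ (λ ()) (λ ()) (λ ()) (λ ()) (R⊆G (here refl)))
    neg-cofacet q s< (neg _ _) R⊆G with R⊆G (here refl)
    ... | there (there (here refl)) = inj₁ refl
    ... | there (there (there (here refl))) = ⊥-elim (∉⁴ (λ ()) (λ ()) (λ ()) (λ ()) (R⊆G (there (here refl))))
    neg-cofacet q s< wrap R⊆G with R⊆G (here refl)
    ... | there (there (here refl)) = ⊥-elim (ℕ.<-irrefl refl s<)
    ... | there (there (there (here ())))
    neg-cofacet q s< cone⁺ R⊆G = inj₂ refl
    neg-cofacet q s< cone⁻ R⊆G with R⊆G (here refl)
    ... | here refl = ⊥-elim (≮-suc (ℕ.<-trans (ℕ.n<1+n _) s<))
    ... | there (here refl) = ⊥-elim (≮-suc s<)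
    ... | there (there (there (here refl))) = ⊥-elim (ℕ.<-irrefl refl s<)

  ridge-neg⁺ : ∀ s → s < suc j → FreeRidge K (P4 ∷ -[1+ s ] ∷ -[1+ suc s ] ∷ [])
  ridge-neg⁺ s s< = freeRidge-split (P4 ∷ []) (∈-B31⁺ j (neg s s<)) (∉³ (λ ()) (λ ()) (λ ())) unique
    where
    unique : ∀ {G} → G ∈ K → P4 ∷ -[1+ s ] ∷ -[1+ suc s ] ∷ [] ⊆ G → G ≈ P4 ∷ P3 ∷ -[1+ s ] ∷ -[1+ suc s ] ∷ []
    unique G∈ R⊆G with neg-cofacet P4 s< (∈-B31⁻ j G∈) (λ { (here refl) → R⊆G (there (here refl))
                                                           ; (there (here refl)) → R⊆G (there (there (here refl)))
                                                           ; (there (there (here refl))) → R⊆G (here refl) })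
    ... | inj₁ refl = ≈-refl
    ... | inj₂ refl with R⊆G (there (here refl))
    ...   | there (here refl) = ⊥-elim (≮-suc s<)
    ...   | there (there (there (here refl))) = ⊥-elim (ℕ.<-irrefl refl s<)

  ridge-neg⁰ : ∀ s → s < suc j → FreeRidge K (P3 ∷ -[1+ s ] ∷ -[1+ suc s ] ∷ [])
  ridge-neg⁰ s s< = freeRidge-split [] (∈-B31⁺ j (neg s s<)) (∉³ (λ ()) (λ ()) (λ ())) unique
    where
    unique : ∀ {G} → G ∈ K → P3 ∷ -[1+ s ] ∷ -[1+ suc s ] ∷ [] ⊆ G → G ≈ P4 ∷ P3 ∷ -[1+ s ] ∷ -[1+ suc s ] ∷ []
    unique G∈ R⊆G with neg-cofacet P3 s< (∈-B31⁻ j G∈) (λ { (here refl) → R⊆G (there (here refl))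
                                                           ; (there (here refl)) → R⊆G (there (there (here refl)))
                                                           ; (there (there (here refl))) → R⊆G (here refl) })
    ... | inj₁ refl = ≈-refl
    ... | inj₂ refl = ⊥-elim (∉⁴ (λ ()) (λ ()) (λ ()) (λ ()) (R⊆G (here refl)))

cone-face⁺ : ∀ j {R} → FreeRidge (B31 (4 + j)) R → IsFace (+ (5 + j) ∷ R) (Δ3′ (suc j))
cone-face⁺ j {R} free with r , r∈ , R⊆r ← find (FreeRidge⇒boundary free) =
  lose (∈-++⁺ʳ (minusC (minusC (Δ3′ j) (B31 (4 + j))) (negC (B31 (4 + j)))) (∈-++⁺ˡ (∈-map⁺ _ r∈)))
       λ { (here refl) → here refl ; (there x∈R) → there (R⊆r x∈R) }

cone-face⁻ : ∀ j {R} → FreeRidge (negC (B31 (4 + j))) R → IsFace (-[1+ 4 + j ] ∷ R) (Δ3′ (suc j))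
cone-face⁻ j {R} free with r , r∈ , R⊆r ← find (FreeRidge⇒boundary free) =
  lose (∈-++⁺ʳ (minusC (minusC (Δ3′ j) (B31 (4 + j))) (negC (B31 (4 + j))))
         (∈-++⁺ʳ (joinV (+ (5 + j)) (boundary (B31 (4 + j)))) (∈-map⁺ _ r∈)))
       λ { (here refl) → here refl ; (there x∈R) → there (R⊆r x∈R) }

Avoids± : ℕ → Face → Set
Avoids± u F = + suc u ∉ F × -[1+ u ] ∉ F

private
  ∣∣≡suc : ∀ {p u} → ∣ p ∣ ≡ suc u → p ≡ + suc u ⊎ p ≡ -[1+ u ]
  ∣∣≡suc {+ _} refl = inj₁ refl
  ∣∣≡suc { -[1+ _ ]} refl = inj₂ refl

  ∉-by-∣∣ : ∀ {p u F} → ∣ p ∣ ≡ suc u → Avoids± u F → p ∉ F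
  ∉-by-∣∣ {p} ∣p∣≡ (+∉ , -∉) with ∣∣≡suc {p} ∣p∣≡
  ... | inj₁ refl = +∉
  ... | inj₂ refl = -∉

  B31Shape : ℕ → Face → Set
  B31Shape i H = ∃[ p ] ∃[ q ] ∃[ r ] ∃[ s ] H ≡ p ∷ q ∷ r ∷ s ∷ [] × ∣ p ∣ ≡ 4 + i × ∣ q ∣ ≡ 3 + i

  B31-shape : ∀ i {H} → H ∈ B31 (4 + i) → B31Shape i H
  B31-shape i H∈ with ∈-B31⁻ i H∈
  ... | pos _ _ = _ , _ , _ , _ , refl , refl , refl
  ... | neg _ _ = _ , _ , _ , _ , refl , refl , refl
  ... | wrap = _ , _ , _ , _ , refl , refl , refl
  ... | cone⁺ = _ , _ , _ , _ , refl , refl , refl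
  ... | cone⁻ = _ , _ , _ , _ , refl , refl , refl

  negB31-shape : ∀ i {H} → H ∈ negC (B31 (4 + i)) → B31Shape i H
  negB31-shape i H∈ with H₀ , H₀∈ , refl ← ∈-map⁻ _ H∈ with B31-shape i H₀∈
  ... | p , q , r , s , refl , ∣p∣ , ∣q∣ = _ , _ , _ , _ , refl , ≡-trans (ℤ.∣-i∣≡∣i∣ p) ∣p∣ , ≡-trans (ℤ.∣-i∣≡∣i∣ q) ∣q∣

  not-in-shape : ∀ i {F H} → Unique F → length F ≡ 4 → Avoids± (3 + i) F ⊎ Avoids± (2 + i) F →
                 B31Shape i H → ¬ F ⊆ H
  not-in-shape i {F} uniq len (inj₁ avoids) (p , q , r , s , refl , ∣p∣ , _) F⊆H =
    ℕ.<-irrefl refl (subst (_≤ 3) len (⊆⇒length≤ uniq F⊆qrs))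
    where
    F⊆qrs : F ⊆ q ∷ r ∷ s ∷ []
    F⊆qrs x∈F with F⊆H x∈F
    ... | here refl = ⊥-elim (∉-by-∣∣ ∣p∣ avoids x∈F)
    ... | there x∈ = x∈
  not-in-shape i {F} uniq len (inj₂ avoids) (p , q , r , s , refl , _ , ∣q∣) F⊆H =
    ℕ.<-irrefl refl (subst (_≤ 3) len (⊆⇒length≤ uniq F⊆prs))
    where
    F⊆prs : F ⊆ p ∷ r ∷ s ∷ []
    F⊆prs x∈F with F⊆H x∈F
    ... | here refl = here refl
    ... | there (here refl) = ⊥-elim (∉-by-∣∣ ∣q∣ avoids x∈F)
    ... | there (there x∈) = there x∈

facet-survives : ∀ j {F} → Unique F → length F ≡ 4 → Avoids± (3 + j) F ⊎ Avoids± (2 + j) F →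
                 IsFace F (Δ3′ j) → IsFace F (Δ3′ (suc j))
facet-survives j uniq len avoids F∈ with G , G∈ , F⊆G ← find F∈ =
  lose (∈-++⁺ˡ (∈-minusC⁺ _ _ (∈-minusC⁺ _ _ G∈ (not-face (B31-shape j))) (not-face (negB31-shape j)))) F⊆G
  where
  not-face : ∀ {L} → (∀ {H} → H ∈ L → B31Shape j H) → ¬ IsFace G L
  not-face shape G∈L with H , H∈ , G⊆H ← find G∈L = not-in-shape j uniq len avoids (shape H∈) (⊆-trans F⊆G G⊆H)

facet-persists : ∀ {F} j → Unique F → length F ≡ 4 → IsFace F (Δ3′ j) →
                 (∀ i → j ≤ i → Avoids± (3 + i) F ⊎ Avoids± (2 + i) F) → ∀ j′ → j ≤ j′ → IsFace F (Δ3′ j′)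
facet-persists j uniq len F∈ avoids zero z≤n = F∈
facet-persists j uniq len F∈ avoids (suc j′) j≤ with ℕ.m≤n⇒m<n∨m≡n j≤
... | inj₂ refl = F∈
... | inj₁ (s≤s j≤j′) = facet-survives j′ uniq len (avoids j′ j≤j′) (facet-persists j uniq len F∈ avoids j′ j≤j′)

-- The facets of B(I)

∈-range⁻ : ∀ a b {x} → x ∈ range a b → a ≤ x × x ≤ b
∈-range⁻ a b x∈ with y , y∈ , refl ← ∈-map⁻ (λ k → a + k) x∈ = ℕ.m≤m+n a y , ℕ.≤-pred a+y<1+b
  where
  open ℕ.≤-Reasoning
  y< : y < suc b ∸ a
  y< = ∈-upTo⁻ y∈
  a+y<1+b : a + y < suc b
  a+y<1+b = begin-strict
    a + y          <⟨ ℕ.+-monoʳ-< a y< ⟩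
    a + (suc b ∸ a) ≡⟨ ℕ.m+[n∸m]≡n {a} (ℕ.<⇒≤ (ℕ.m∸n≢0⇒n<m λ eq → ℕ.n≮0 (subst (y <_) eq y<))) ⟩
    suc b          ∎

∈-range⁺ : ∀ a b {x} → a ≤ x → x ≤ b → x ∈ range a b
∈-range⁺ a b {x} a≤x x≤b = subst (_∈ range a b) (ℕ.m+[n∸m]≡n a≤x)
  (∈-map⁺ (λ k → a + k) (∈-upTo⁺ (subst (x ∸ a <_) (sym (ℕ.+-∸-assoc 1 (ℕ.≤-trans a≤x x≤b))) (s≤s (ℕ.∸-monoˡ-≤ a x≤b)))))

module BIⁿᶠ (n : ℕ) where
  private
    N : ℤ
    N = + n

  next : List ℕ → ℕ
  next [] = n ∸ 2
  next (b ∷ _) = b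

  A′ Fan′ Head′ : ℕ → Face
  A′ i = + 1 ∷ + 2 ∷ + i ∷ + (i + 2) ∷ []
  Fan′ m = ℤ.- N ℤ.+ + suc m ∷ ℤ.- N ℤ.+ + m ∷ N ℤ.- + 1 ∷ N ∷ []
  Head′ a = + 1 ∷ ℤ.- N ℤ.+ + (a + 2) ∷ N ℤ.- + suc a ∷ N ℤ.- + a ℤ.+ + 1 ∷ []

  Block′ : ℕ → ℕ → Face
  Block′ a m = ℤ.- N ℤ.+ + suc m ∷ ℤ.- N ℤ.+ + m ∷ N ℤ.- + suc a ∷ N ℤ.- + a ℤ.+ + 1 ∷ []

  Special′ : Complex
  Special′ = (+ 1 ∷ + 2 ∷ N ℤ.- + 1 ∷ N ∷ [])
           ∷ (+ 1 ∷ ℤ.- N ℤ.+ + 2 ∷ N ℤ.- + 1 ∷ N ∷ [])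
           ∷ (+ 1 ∷ ℤ.- N ℤ.+ + 2 ∷ ℤ.- N ℤ.+ + 1 ∷ N ∷ [])
           ∷ (+ 1 ∷ ℤ.- N ℤ.+ + 2 ∷ ℤ.- N ℤ.+ + 1 ∷ ℤ.- N ∷ [])
           ∷ []

  blocks : List ℕ → Complex
  blocks [] = []
  blocks (a ∷ rest) = Head′ a ∷ map (Block′ a) (range (a + 2) (next rest)) ++ blocks rest

  BI′ : List ℕ → Complex
  BI′ I = map A′ (range 3 (n ∸ 2)) ++ Special′ ++ map Fan′ (range 2 (next I)) ++ blocks I

  blocks-unique : ∀ {f : List ℕ → Complex} {g : List ℕ → ℕ} → g [] ≡ n ∸ 2 → (∀ b r → g (b ∷ r) ≡ b) →
                  f [] ≡ [] → (∀ b r → f (b ∷ r) ≡ Head′ b ∷ map (Block′ b) (range (b + 2) (g r)) ++ f r) →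
                  ∀ J → f J ≡ blocks J
  blocks-unique g[] g∷ f[] f∷ [] = f[]
  blocks-unique {f} {g} g[] g∷ f[] f∷ (b ∷ r) = ≡-trans (f∷ b r)
    (cong₂ (λ m L → Head′ b ∷ map (Block′ b) (range (b + 2) m) ++ L) (g≡next r) (blocks-unique g[] g∷ f[] f∷ r))
    where
    g≡next : ∀ r → g r ≡ next r
    g≡next [] = g[]
    g≡next (c ∷ _) = g∷ c _

-- BI's where-bound `next` and `blocks` are out of scope; the two metavariables
-- below are solved by unification against them (after the `with` their
-- parameter `a ∷ rest` is a variable, so the problem is a pattern).
mutual
  private
    hidden-blocks : ℕ → List ℕ → List ℕ → Complex
    hidden-blocks = _
    hidden-next : ℕ → List ℕ → List ℕ → ℕ
    hidden-next = _

    name-hidden : ∀ n a rest → BI n (a ∷ rest) ≡ BI n (a ∷ rest)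
    name-hidden n a rest with a ∷ rest
    ... | X = cong (λ z → map (BIⁿᶠ.A′ n) (range 3 (n ∸ 2)) ++ BIⁿᶠ.Special′ n ++ map (BIⁿᶠ.Fan′ n) (range 2 a)
                       ++ (BIⁿᶠ.Head′ n a ∷ map (BIⁿᶠ.Block′ n a) (range (a + 2) (hidden-next n X rest)) ++ z))
                   (refl {x = hidden-blocks n X rest})

BI≡BI′ : ∀ n I → BI n I ≡ BIⁿᶠ.BI′ n I
BI≡BI′ n [] = refl
BI≡BI′ n (a ∷ rest) = cong (λ L → map (A′ n) (range 3 (n ∸ 2)) ++ Special′ n ++ map (Fan′ n) (range 2 a) ++ L)
  (cong₂ (λ m L → Head′ n a ∷ map (Block′ n a) (range (a + 2) m) ++ L)
     (g≡ rest) (blocks-unique n {hidden-blocks n (a ∷ rest)} {hidden-next n (a ∷ rest)} refl (λ _ _ → refl) refl (λ _ _ → refl) rest))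
  where
  open BIⁿᶠ
  g≡ : ∀ r → hidden-next n (a ∷ rest) r ≡ next n r
  g≡ [] = refl
  g≡ (_ ∷ _) = refl

-[m+1+n]+m≡-[1+n] : ∀ m n {N} → m + suc n ≡ N → ℤ.- (+ N) ℤ.+ + m ≡ -[1+ n ]
-[m+1+n]+m≡-[1+n] m n refl = ≡-trans (ℤ.-m+n≡n⊖m (m + suc n) m)
  (≡-trans (ℤ.⊖-≤ (ℕ.m≤m+n m (suc n))) (cong (λ z → ℤ.- (+ z)) (ℕ.m+n∸m≡n m (suc n))))

[m+n]-m≡n : ∀ m n {N} → m + n ≡ N → + N ℤ.- + m ≡ + n
[m+n]-m≡n m n refl = ≡-trans (ℤ.m-n≡m⊖n (m + n) m) (≡-trans (ℤ.⊖-≥ (ℕ.m≤m+n m n)) (cong +_ (ℕ.m+n∸m≡n m n)))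

private
  1+m+[1+s]≡ : ∀ m s → suc m + suc s ≡ 2 + (m + s)
  1+m+[1+s]≡ = solve-∀
  m+[2+s]≡ : ∀ m s → m + suc (suc s) ≡ 2 + (m + s)
  m+[2+s]≡ = solve-∀
  a+2+[1+c]≡ : ∀ a c → a + 2 + suc c ≡ 3 + (a + c)
  a+2+[1+c]≡ = solve-∀
  1+a+[2+c]≡ : ∀ a c → suc a + (2 + c) ≡ 3 + (a + c)
  1+a+[2+c]≡ = solve-∀
  a+[3+c]≡ : ∀ a c → a + (3 + c) ≡ 3 + (a + c)
  a+[3+c]≡ = solve-∀

module Facets (k : ℕ) where
  n : ℕ
  n = 10 + k

  open BIⁿᶠ n public

  A : ℕ → Face
  A i = + 1 ∷ + 2 ∷ + i ∷ + (2 + i) ∷ []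

  S₀ S₁ S₂ S₃ : Face
  S₀ = + 1 ∷ + 2 ∷ + (9 + k) ∷ + (10 + k) ∷ []
  S₁ = + 1 ∷ -[1+ 7 + k ] ∷ + (9 + k) ∷ + (10 + k) ∷ []
  S₂ = + 1 ∷ -[1+ 7 + k ] ∷ -[1+ 8 + k ] ∷ + (10 + k) ∷ []
  S₃ = + 1 ∷ -[1+ 7 + k ] ∷ -[1+ 8 + k ] ∷ -[1+ 9 + k ] ∷ []

  Fan : ℕ → Face
  Fan s = -[1+ s ] ∷ -[1+ suc s ] ∷ + (9 + k) ∷ + (10 + k) ∷ []

  Head : ℕ → Face
  Head c = + 1 ∷ -[1+ c ] ∷ + (2 + c) ∷ + (4 + c) ∷ []

  Block : ℕ → ℕ → Face
  Block c s = -[1+ s ] ∷ -[1+ suc s ] ∷ + (2 + c) ∷ + (4 + c) ∷ []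

  -- In the paper's notation Fan s has m = 8 + k - s, and Head c, Block c s
  -- belong to the element i_j = 7 + k - c of I.
  data IsFacet : Face → Set where
    isA : ∀ i → 3 ≤ i → i ≤ 8 + k → IsFacet (A i)
    isS₀ : IsFacet S₀
    isS₁ : IsFacet S₁
    isS₂ : IsFacet S₂
    isS₃ : IsFacet S₃
    isFan : ∀ s → s ≤ 6 + k → IsFacet (Fan s)
    isHead : ∀ c → 3 ≤ c → c ≤ 4 + k → IsFacet (Head c)
    isBlock : ∀ c s → 3 ≤ c → c ≤ 4 + k → s < c → IsFacet (Block c s)

  A′≡A : ∀ i → A′ i ≡ A i
  A′≡A i = cong (λ z → + 1 ∷ + 2 ∷ + i ∷ + z ∷ []) (ℕ.+-comm i 2)

  module _ {m s} (m+s≡ : m + s ≡ 8 + k) where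
    -n+[1+m]≡ : ℤ.- (+ n) ℤ.+ + suc m ≡ -[1+ s ]
    -n+[1+m]≡ = -[m+1+n]+m≡-[1+n] (suc m) s (≡-trans (1+m+[1+s]≡ m s) (cong (2 ℕ.+_) m+s≡))

    -n+m≡ : ℤ.- (+ n) ℤ.+ + m ≡ -[1+ suc s ]
    -n+m≡ = -[m+1+n]+m≡-[1+n] m (suc s) (≡-trans (m+[2+s]≡ m s) (cong (2 ℕ.+_) m+s≡))

    Fan′≡Fan : Fan′ m ≡ Fan s
    Fan′≡Fan = cong₂ (λ u v → u ∷ v ∷ + (9 + k) ∷ + (10 + k) ∷ []) -n+[1+m]≡ -n+m≡

  module _ {a c} (a+c≡ : a + c ≡ 7 + k) where
    -n+[a+2]≡ : ℤ.- (+ n) ℤ.+ + (a + 2) ≡ -[1+ c ]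
    -n+[a+2]≡ = -[m+1+n]+m≡-[1+n] (a + 2) c (≡-trans (a+2+[1+c]≡ a c) (cong (3 ℕ.+_) a+c≡))

    n-[1+a]≡ : + n ℤ.- + suc a ≡ + (2 + c)
    n-[1+a]≡ = [m+n]-m≡n (suc a) (2 + c) (≡-trans (1+a+[2+c]≡ a c) (cong (3 ℕ.+_) a+c≡))

    n-a+1≡ : + n ℤ.- + a ℤ.+ + 1 ≡ + (4 + c)
    n-a+1≡ = ≡-trans (cong (ℤ._+ + 1) ([m+n]-m≡n a (3 + c) (≡-trans (a+[3+c]≡ a c) (cong (3 ℕ.+_) a+c≡))))
                     (cong +_ (ℕ.+-comm (3 + c) 1))

    Head′≡Head : Head′ a ≡ Head c
    Head′≡Head = cong₂ (λ u v → + 1 ∷ u ∷ v) -n+[a+2]≡ (cong₂ (λ u v → u ∷ v ∷ []) n-[1+a]≡ n-a+1≡)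

    Block′≡Block : ∀ {m s} → m + s ≡ 8 + k → Block′ a m ≡ Block c s
    Block′≡Block m+s≡ = cong₂ _∷_ (-n+[1+m]≡ m+s≡) (cong₂ _∷_ (-n+m≡ m+s≡) (cong₂ (λ u v → u ∷ v ∷ []) n-[1+a]≡ n-a+1≡))

  next≤ : ∀ {I} → AllIn n I → next I ≤ 8 + k
  next≤ [] = ℕ.≤-refl
  next≤ ((_ , i≤) ∷ _) = ℕ.≤-trans i≤ (ℕ.m≤n+m (4 + k) 4)

  isFan′ : ∀ m → 2 ≤ m → m ≤ 8 + k → IsFacet (Fan′ m)
  isFan′ m 2≤m m≤ = subst IsFacet (sym (Fan′≡Fan (ℕ.m+[n∸m]≡n m≤))) (isFan _ (ℕ.∸-monoʳ-≤ (8 + k) 2≤m))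

  complement : ∀ a → 3 ≤ a → a ≤ 4 + k → ∃[ c ] a + c ≡ 7 + k × 3 ≤ c × c ≤ 4 + k
  complement a 3≤a a≤ = 7 + k ∸ a , ℕ.m+[n∸m]≡n (ℕ.≤-trans a≤ (ℕ.m≤n+m (4 + k) 3)) ,
                        subst (_≤ 7 + k ∸ a) (ℕ.m+n∸n≡m 3 (4 + k)) (ℕ.∸-monoʳ-≤ (7 + k) a≤) , ℕ.∸-monoʳ-≤ (7 + k) 3≤a

  block-s<c : ∀ {a c m s} → a + c ≡ 7 + k → m + s ≡ 8 + k → a + 2 ≤ m → s < c
  block-s<c {a} {c} {m} {s} a+c≡ m+s≡ a+2≤m = ℕ.+-cancelˡ-< (a + 2) s c (begin-strict
    a + 2 + s      ≤⟨ ℕ.+-monoˡ-≤ s a+2≤m ⟩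
    m + s          ≡⟨ m+s≡ ⟩
    8 + k          ≡⟨ cong suc (sym a+c≡) ⟩
    suc (a + c)    <⟨ ℕ.n<1+n _ ⟩
    2 + (a + c)    ≡⟨ a+2+c≡ a c ⟩
    a + 2 + c      ∎)
    where
    open ℕ.≤-Reasoning
    a+2+c≡ : ∀ a c → 2 + (a + c) ≡ a + 2 + c
    a+2+c≡ = solve-∀

  isFacet-blocks : ∀ {I} → AllIn n I → ∀ {F} → F ∈ blocks I → IsFacet F
  isFacet-blocks {a ∷ rest} ((3≤a , a≤) ∷ rest∈) F∈ with c , a+c≡ , 3≤c , c≤ ← complement a 3≤a a≤ with F∈
  ... | here refl = subst IsFacet (sym (Head′≡Head a+c≡)) (isHead c 3≤c c≤)
  ... | there F∈′ with ∈-++⁻ (map (Block′ a) (range (a + 2) (next rest))) F∈′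
  ...   | inj₂ F∈rest = isFacet-blocks rest∈ F∈rest
  ...   | inj₁ F∈block with m , m∈ , refl ← ∈-map⁻ (Block′ a) F∈block with ∈-range⁻ (a + 2) (next rest) m∈
  ...     | a+2≤m , m≤ = subst IsFacet (sym (Block′≡Block a+c≡ m+s≡)) (isBlock c s 3≤c c≤ (block-s<c a+c≡ m+s≡ a+2≤m))
    where
    s = 8 + k ∸ m
    m+s≡ : m + s ≡ 8 + k
    m+s≡ = ℕ.m+[n∸m]≡n (ℕ.≤-trans m≤ (next≤ rest∈))

  isFacet : ∀ {I} → AllIn n I → ∀ {F} → F ∈ BI′ I → IsFacet F
  isFacet {I} I∈ F∈ with ∈-++⁻ (map A′ (range 3 (8 + k))) F∈
  ... | inj₁ F∈A with i , i∈ , refl ← ∈-map⁻ A′ F∈A with ∈-range⁻ 3 (8 + k) i∈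
  ...   | 3≤i , i≤ = subst IsFacet (sym (A′≡A i)) (isA i 3≤i i≤)
  isFacet I∈ F∈ | inj₂ (here refl) = isS₀
  isFacet I∈ F∈ | inj₂ (there (here refl)) = isS₁
  isFacet I∈ F∈ | inj₂ (there (there (here refl))) = isS₂
  isFacet I∈ F∈ | inj₂ (there (there (there (here refl)))) = isS₃
  isFacet {I} I∈ F∈ | inj₂ (there (there (there (there F∈′)))) with ∈-++⁻ (map Fan′ (range 2 (next I))) F∈′
  ... | inj₂ F∈blocks = isFacet-blocks I∈ F∈blocks
  ... | inj₁ F∈fan with m , m∈ , refl ← ∈-map⁻ Fan′ F∈fan with ∈-range⁻ 2 (next I) m∈
  ...   | 2≤m , m≤ = isFan′ m 2≤m (ℕ.≤-trans m≤ (next≤ I∈))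

-- B(I) ⊆ Δ^3_n

1+d+n≰n : ∀ d {n} → ¬ suc d + n ≤ n
1+d+n≰n d d+n≤n = ℕ.1+n≰n (ℕ.≤-trans (s≤s (ℕ.m≤n+m _ d)) d+n≤n)

unique⁴ : ∀ {a b c d : ℤ} → a ≢ b → a ≢ c → a ≢ d → b ≢ c → b ≢ d → c ≢ d → Unique (a ∷ b ∷ c ∷ d ∷ [])
unique⁴ a≢b a≢c a≢d b≢c b≢d c≢d = (a≢b ∷ a≢c ∷ a≢d ∷ []) ∷ (b≢c ∷ b≢d ∷ []) ∷ (c≢d ∷ []) ∷ [] ∷ []

avoids-after : ∀ {F} j → Avoids± (3 + j) F → (∀ i → 2 + j ≤ i → Avoids± (3 + i) F) →
               ∀ i → suc j ≤ i → Avoids± (3 + i) F ⊎ Avoids± (2 + i) F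
avoids-after j now later i j<i with ℕ.m≤n⇒m<n∨m≡n j<i
... | inj₂ refl = inj₂ now
... | inj₁ j+1<i = inj₁ (later i j+1<i)

module Containment (k : ℕ) where
  open Facets k
  open B31Ridges

  -- Δ3′ (suc (5 + k)) and Δ3′ (6 + k) are convertible, but checking that by
  -- unfolding Δ3′ is prohibitively expensive; this cast compares the indices.
  last-step : ∀ {σ} → IsFace σ (Δ3′ (suc (5 + k))) → IsFace σ (Δ3′ (6 + k))
  last-step {σ} = subst (λ j → IsFace σ (Δ3′ j)) {x = suc (5 + k)} {y = 6 + k} refl

  A⊆Δ3 : ∀ i → 3 ≤ i → i ≤ 8 + k → IsFace (A i) (Δ3′ (6 + k))
  A⊆Δ3 .(3 + j) (s≤s (s≤s (s≤s (z≤n {j})))) i≤ =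
    facet-persists (suc j) (unique⁴ (λ ()) (λ ()) (λ ()) (λ ()) (λ ()) (λ ())) refl
      (IsFace-⊆ (λ { (here refl) → there (there (here refl)) ; (there (here refl)) → there (there (there (here refl)))
                   ; (there (there (here refl))) → there (here refl) ; (there (there (there (here refl)))) → here refl })
                (cone-face⁺ j (ridge-12 j)))
      (avoids-after j (∉⁴ (λ ()) (λ ()) (λ ()) (λ ()) , ∉⁴ (λ ()) (λ ()) (λ ()) (λ ()))
        λ i j+2≤i → (λ { (there (there (here refl))) → 1+d+n≰n 2 j+2≤i ; (there (there (there (here refl)))) → 1+d+n≰n 0 j+2≤i })
                  , ∉⁴ (λ ()) (λ ()) (λ ()) (λ ()))
      (6 + k) (ℕ.≤-pred (ℕ.≤-pred i≤))

  Head⊆Δ3 : ∀ c → 3 ≤ c → c ≤ 4 + k → IsFace (Head c) (Δ3′ (6 + k))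
  Head⊆Δ3 .(suc j) (s≤s {n = j} _) c≤ =
    facet-persists (suc j) (unique⁴ (λ ()) (λ ()) (λ ()) (λ ()) (λ ()) (λ ())) refl
      (IsFace-⊆ (λ { (here refl) → there (there (there (here refl))) ; (there (here refl)) → there (there (here refl))
                   ; (there (there (here refl))) → there (here refl) ; (there (there (there (here refl)))) → here refl })
                (cone-face⁺ j (ridge-wrap j)))
      (avoids-after j (∉⁴ (λ ()) (λ ()) (λ ()) (λ ()) , ∉⁴ (λ ()) (λ ()) (λ ()) (λ ()))
        λ i j+2≤i → (λ { (there (there (here refl))) → 1+d+n≰n 2 j+2≤i ; (there (there (there (here refl)))) → 1+d+n≰n 0 j+2≤i })
                  , λ { (there (here refl)) → 1+d+n≰n 3 j+2≤i ; (there (there (there (there ())))) })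
      (6 + k) (ℕ.≤-trans c≤ (ℕ.m≤n+m (4 + k) 2))

  Block⊆Δ3 : ∀ c s → 3 ≤ c → c ≤ 4 + k → s < c → IsFace (Block c s) (Δ3′ (6 + k))
  Block⊆Δ3 .(suc j) s (s≤s {n = j} _) c≤ s<c =
    facet-persists (suc j) (unique⁴ (λ ()) (λ ()) (λ ()) (λ ()) (λ ()) (λ ())) refl
      (IsFace-⊆ (λ { (here refl) → there (there (here refl)) ; (there (here refl)) → there (there (there (here refl)))
                   ; (there (there (here refl))) → there (here refl) ; (there (there (there (here refl)))) → here refl })
                (cone-face⁺ j (ridge-neg⁰ j s s<c)))
      (avoids-after j (∉⁴ (λ ()) (λ ()) (λ ()) (λ ())
                      , λ { (here refl) → 1+d+n≰n 2 s<c ; (there (here refl)) → 1+d+n≰n 1 s<c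
                          ; (there (there (there (there ())))) })
        λ i j+2≤i → (λ { (there (there (here refl))) → 1+d+n≰n 2 j+2≤i ; (there (there (there (here refl)))) → 1+d+n≰n 0 j+2≤i })
                  , λ { (here refl) → 1+d+n≰n 3 (ℕ.≤-trans s<c (ℕ.≤-trans (ℕ.n≤1+n (suc j)) j+2≤i))
                      ; (there (here refl)) → 1+d+n≰n 2 (ℕ.≤-trans s<c (ℕ.≤-trans (ℕ.n≤1+n (suc j)) j+2≤i))
                      ; (there (there (there (there ())))) })
      (6 + k) (ℕ.≤-trans c≤ (ℕ.m≤n+m (4 + k) 2))

  Fan⊆Δ3 : ∀ s → s ≤ 6 + k → IsFace (Fan s) (Δ3′ (6 + k))
  Fan⊆Δ3 s s≤ = last-step (fan-cone s (ℕ.m≤n⇒m<n∨m≡n s≤))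
    where
    -- a case split by `with` would normalise the goal, and with it Δ3′
    fan-cone : ∀ s → s < 6 + k ⊎ s ≡ 6 + k → IsFace (Fan s) (Δ3′ (suc (5 + k)))
    fan-cone s (inj₁ s<) =
      IsFace-⊆ (λ { (here refl) → there (there (here refl)) ; (there (here refl)) → there (there (there (here refl)))
                  ; (there (there (here refl))) → there (here refl) ; (there (there (there (here refl)))) → here refl })
               (cone-face⁺ (5 + k) (ridge-neg⁺ (5 + k) s s<))
    fan-cone .(6 + k) (inj₂ refl) =
      IsFace-⊆ (λ { (here refl) → there (there (there (here refl))) ; (there (here refl)) → there (there (here refl))
                  ; (there (there (here refl))) → there (here refl) ; (there (there (there (here refl)))) → here refl })
               (cone-face⁺ (5 + k) (ridge-cone⁺-base (5 + k)))

  S₀⊆Δ3 : IsFace S₀ (Δ3′ (6 + k))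
  S₀⊆Δ3 = last-step (IsFace-⊆ (λ { (here refl) → there (there (here refl)) ; (there (here refl)) → there (there (there (here refl)))
                      ; (there (there (here refl))) → there (here refl) ; (there (there (there (here refl)))) → here refl })
                   (cone-face⁺ (5 + k) (ridge-n12 (5 + k))))

  S₁⊆Δ3 : IsFace S₁ (Δ3′ (6 + k))
  S₁⊆Δ3 = last-step (IsFace-⊆ (λ { (here refl) → there (there (there (here refl))) ; (there (here refl)) → there (there (here refl))
                      ; (there (there (here refl))) → there (here refl) ; (there (there (there (here refl)))) → here refl })
                   (cone-face⁺ (5 + k) (ridge-cone⁺ (5 + k))))

  S₂⊆Δ3 : IsFace S₂ (Δ3′ (6 + k))
  S₂⊆Δ3 = last-step (IsFace-⊆ (λ { (here refl) → there (there (there (here refl))) ; (there (here refl)) → there (there (here refl))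
                      ; (there (there (here refl))) → there (here refl) ; (there (there (there (here refl)))) → here refl })
                   (cone-face⁺ (5 + k) (ridge-cone⁻ (5 + k))))

  S₃⊆Δ3 : IsFace S₃ (Δ3′ (6 + k))
  S₃⊆Δ3 = last-step (IsFace-⊆ (λ { (here refl) → there (there (there (here refl))) ; (there (here refl)) → there (there (here refl))
                      ; (there (there (here refl))) → there (here refl) ; (there (there (there (here refl)))) → here refl })
                   (cone-face⁻ (5 + k) (ridge-neg-cone⁻ (5 + k))))

  facet⊆Δ3 : ∀ {F} → IsFacet F → IsFace F (Δ3′ (6 + k))
  facet⊆Δ3 (isA i 3≤i i≤) = A⊆Δ3 i 3≤i i≤
  facet⊆Δ3 isS₀ = S₀⊆Δ3
  facet⊆Δ3 isS₁ = S₁⊆Δ3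
  facet⊆Δ3 isS₂ = S₂⊆Δ3
  facet⊆Δ3 isS₃ = S₃⊆Δ3
  facet⊆Δ3 (isFan s s≤) = Fan⊆Δ3 s s≤
  facet⊆Δ3 (isHead c 3≤c c≤) = Head⊆Δ3 c 3≤c c≤
  facet⊆Δ3 (isBlock c s 3≤c c≤ s<c) = Block⊆Δ3 c s 3≤c c≤ s<c

-- The vertex set of B(I)

module Vertices (k : ℕ) where
  open Facets k

  InV : ℤ → Set
  InV v = ¬ v ≡ + 0 × ∣ v ∣ ≤ 10 + k

  private
    inV⁺ : ∀ {p} → p ≤ 9 + k → InV (+ suc p)
    inV⁺ p≤ = (λ ()) , s≤s p≤

    inV⁻ : ∀ {u} → u ≤ 9 + k → InV -[1+ u ]
    inV⁻ u≤ = (λ ()) , s≤s u≤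

    ≤+ : ∀ {x y} d → x ≤ y → x ≤ d + y
    ≤+ {y = y} d x≤y = ℕ.≤-trans x≤y (ℕ.m≤n+m y d)

    top : 9 + k ≤ 9 + k
    top = ℕ.≤-refl

  facet-in-V : ∀ {F} → IsFacet F → All InV F
  facet-in-V (isA (suc i) _ i≤) = inV⁺ z≤n ∷ inV⁺ (s≤s z≤n) ∷ inV⁺ (≤+ 2 (ℕ.≤-pred i≤)) ∷ inV⁺ (s≤s i≤) ∷ []
  facet-in-V isS₀ = inV⁺ z≤n ∷ inV⁺ (s≤s z≤n) ∷ inV⁺ (≤+ 1 ℕ.≤-refl) ∷ inV⁺ top ∷ []
  facet-in-V isS₁ = inV⁺ z≤n ∷ inV⁻ (≤+ 2 ℕ.≤-refl) ∷ inV⁺ (≤+ 1 ℕ.≤-refl) ∷ inV⁺ top ∷ []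
  facet-in-V isS₂ = inV⁺ z≤n ∷ inV⁻ (≤+ 2 ℕ.≤-refl) ∷ inV⁻ (≤+ 1 ℕ.≤-refl) ∷ inV⁺ top ∷ []
  facet-in-V isS₃ = inV⁺ z≤n ∷ inV⁻ (≤+ 2 ℕ.≤-refl) ∷ inV⁻ (≤+ 1 ℕ.≤-refl) ∷ inV⁻ top ∷ []
  facet-in-V (isFan s s≤) = inV⁻ (≤+ 3 s≤) ∷ inV⁻ (≤+ 2 (s≤s s≤)) ∷ inV⁺ (≤+ 1 ℕ.≤-refl) ∷ inV⁺ top ∷ []
  facet-in-V (isHead c _ c≤) = inV⁺ z≤n ∷ inV⁻ (≤+ 5 c≤) ∷ inV⁺ (≤+ 4 (s≤s c≤)) ∷ inV⁺ (≤+ 2 (s≤s (s≤s (s≤s c≤)))) ∷ []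
  facet-in-V (isBlock c s _ c≤ s<c) = inV⁻ (≤+ 5 (ℕ.≤-trans (ℕ.<⇒≤ s<c) c≤)) ∷ inV⁻ (≤+ 5 (ℕ.≤-trans s<c c≤))
                                    ∷ inV⁺ (≤+ 4 (s≤s c≤)) ∷ inV⁺ (≤+ 2 (s≤s (s≤s (s≤s c≤)))) ∷ []

  ∈BI′-A : ∀ I {i} → 3 ≤ i → i ≤ 8 + k → A i ∈ BI′ I
  ∈BI′-A I 3≤i i≤ = subst (_∈ BI′ I) (A′≡A _) (∈-++⁺ˡ (∈-map⁺ A′ (∈-range⁺ 3 (8 + k) 3≤i i≤)))

  ∈BI′-special : ∀ I {F} → F ∈ Special′ → F ∈ BI′ I
  ∈BI′-special I F∈ = ∈-++⁺ʳ (map A′ (range 3 (8 + k))) (∈-++⁺ˡ F∈)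

  ∈BI′-fan : ∀ I {F} → F ∈ map Fan′ (range 2 (next I)) → F ∈ BI′ I
  ∈BI′-fan I F∈ = ∈-++⁺ʳ (map A′ (range 3 (8 + k))) (∈-++⁺ʳ Special′ (∈-++⁺ˡ F∈))

  ∈BI′-blocks : ∀ I {F} → F ∈ blocks I → F ∈ BI′ I
  ∈BI′-blocks I F∈ = ∈-++⁺ʳ (map A′ (range 3 (8 + k))) (∈-++⁺ʳ Special′ (∈-++⁺ʳ (map Fan′ (range 2 (next I))) F∈))

  private
    -- the vertex -(u + 1) with u ≥ 8 + k - next J is the first vertex of a facet
    -- Fan′ m or Block′ a m with m = 8 + k - u ≤ next J
    m≤next : ∀ {J u} → AllIn n J → 8 + k ∸ next J ≤ u → 8 + k ∸ u ≤ next J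
    m≤next {J} J∈ u≥ = ℕ.≤-trans (ℕ.∸-monoʳ-≤ (8 + k) u≥) (ℕ.≤-reflexive (ℕ.m∸[m∸n]≡n (next≤ J∈)))

    ≤7+k∸a⇒≤8+k : ∀ {a u} → u ≤ 7 + k ∸ a → u ≤ 8 + k
    ≤7+k∸a⇒≤8+k {a} u≤ = ℕ.≤-trans u≤ (ℕ.≤-trans (ℕ.m∸n≤m (7 + k) a) (ℕ.n≤1+n _))

    below-next : ∀ {b u} → b ≤ 7 + k → u < 8 + k ∸ b → u ≤ 7 + k ∸ b
    below-next {b} {u} b≤ u< = ℕ.≤-pred (subst (u <_) (ℕ.+-∸-assoc 1 b≤) u<)

  blocks-cover : ∀ {a rest} → AllIn n (a ∷ rest) → ∀ u → u ≤ 7 + k ∸ a → IsVertex -[1+ u ] (blocks (a ∷ rest))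
  blocks-cover {a} {rest} ((3≤a , a≤) ∷ rest∈) u u≤c with ℕ.m≤n⇒m<n∨m≡n u≤c
  ... | inj₂ refl = lose (here refl) (subst (-[1+ u ] ∈_) (sym (Head′≡Head {a} a+c≡)) (there (here refl)))
    where
    a+c≡ : a + (7 + k ∸ a) ≡ 7 + k
    a+c≡ = ℕ.m+[n∸m]≡n (ℕ.≤-trans a≤ (ℕ.m≤n+m (4 + k) 3))
  ... | inj₁ u<c with 8 + k ∸ next rest ≤? u
  ...   | yes u≥ = lose (there (∈-++⁺ˡ (∈-map⁺ (Block′ a) (∈-range⁺ (a + 2) (next rest) a+2≤m (m≤next rest∈ u≥)))))
                        (subst (-[1+ u ] ∈_) (sym (Block′≡Block {a} a+c≡ {8 + k ∸ u} (ℕ.m∸n+n≡m (≤7+k∸a⇒≤8+k {a} u≤c)))) (here refl))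
    where
    a+c≡ : a + (7 + k ∸ a) ≡ 7 + k
    a+c≡ = ℕ.m+[n∸m]≡n (ℕ.≤-trans a≤ (ℕ.m≤n+m (4 + k) 3))
    a+2≤m : a + 2 ≤ 8 + k ∸ u
    a+2≤m = ℕ.+-cancelʳ-≤ u (a + 2) (8 + k ∸ u) (begin
      a + 2 + u        ≡⟨ ℕ.+-assoc a 2 u ⟩
      a + (2 + u)      ≤⟨ ℕ.+-monoʳ-≤ a (s≤s u<c) ⟩
      a + suc (7 + k ∸ a) ≡⟨ ℕ.+-suc a _ ⟩
      suc (a + (7 + k ∸ a)) ≡⟨ cong suc a+c≡ ⟩
      8 + k            ≡⟨ ℕ.m∸n+n≡m (≤7+k∸a⇒≤8+k {a} u≤c) ⟨
      8 + k ∸ u + u    ∎)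
      where open ℕ.≤-Reasoning
  ...   | no u≱ with rest | rest∈
  ...     | [] | _ = ⊥-elim (u≱ (subst (_≤ u) (sym (ℕ.n∸n≡0 (8 + k))) z≤n))
  ...     | b ∷ rest′ | b∈@((_ , b≤) ∷ _) =
    let F , F∈ , u∈F = find (blocks-cover b∈ u (below-next (ℕ.≤-trans b≤ (ℕ.m≤n+m (4 + k) 3)) (ℕ.≰⇒> u≱)))
    in lose (there (∈-++⁺ʳ (map (Block′ a) (range (a + 2) b)) F∈)) u∈F

  V⊆vertices : ∀ {I} → AllIn n I → ∀ v → InV v → IsVertex v (BI′ I)
  V⊆vertices I∈ (+ zero) (≢0 , _) = ⊥-elim (≢0 refl)
  V⊆vertices {I} I∈ (+ suc p) (_ , s≤s p≤) with 2 ≤? p | suc p ≤? 8 + k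
  ... | no p≱2 | _ = lose (∈BI′-special I (here refl)) (small p (ℕ.≰⇒> p≱2))
    where
    small : ∀ p → p < 2 → + suc p ∈ S₀
    small 0 _ = here refl
    small 1 _ = there (here refl)
    small (suc (suc _)) (s≤s (s≤s ()))
  ... | yes 2≤p | yes p+1≤ = lose (∈BI′-A I (s≤s 2≤p) p+1≤) (there (there (here refl)))
  ... | yes _ | no p+1≰ with ℕ.m≤n⇒m<n∨m≡n p≤
  ...   | inj₂ refl = lose (∈BI′-special I (here refl)) (there (there (there (here refl))))
  ...   | inj₁ p<9+k = lose (∈BI′-special I (here refl))
                            (there (there (here (cong (λ z → + suc z) (ℕ.≤-antisym (ℕ.≤-pred p<9+k) (ℕ.≤-pred (ℕ.≰⇒> p+1≰)))))))
  V⊆vertices {I} I∈ -[1+ u ] (_ , s≤s u≤) with 7 + k ≤? u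
  ... | yes u≥ = lose (∈BI′-special I (there (there (there (here refl))))) (top-three u≥ u≤)
    where
    top-three : 7 + k ≤ u → u ≤ 9 + k → -[1+ u ] ∈ S₃
    top-three u≥ u≤ with ℕ.m≤n⇒m<n∨m≡n u≥
    ... | inj₂ refl = there (here refl)
    ... | inj₁ u> with ℕ.m≤n⇒m<n∨m≡n u>
    ...   | inj₂ refl = there (there (here refl))
    ...   | inj₁ u>′ = there (there (there (here (cong -[1+_] (ℕ.≤-antisym u≤ u>′)))))
  ... | no u≱ with 8 + k ∸ next I ≤? u
  ...   | yes u≥ = lose (∈BI′-fan I (∈-map⁺ Fan′ (∈-range⁺ 2 (next I) 2≤m (m≤next I∈ u≥))))
                        (subst (-[1+ u ] ∈_) (sym (Fan′≡Fan {8 + k ∸ u} (ℕ.m∸n+n≡m u≤8+k))) (here refl))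
    where
    u≤8+k : u ≤ 8 + k
    u≤8+k = ℕ.≤-trans (ℕ.<⇒≤ (ℕ.≰⇒> u≱)) (ℕ.n≤1+n _)
    2≤m : 2 ≤ 8 + k ∸ u
    2≤m = subst (_≤ 8 + k ∸ u) (ℕ.m+n∸n≡m 2 (6 + k)) (ℕ.∸-monoʳ-≤ (8 + k) (ℕ.≤-pred (ℕ.≰⇒> u≱)))
  ...   | no u≱′ with I | I∈
  ...     | [] | _ = ⊥-elim (u≱′ (subst (_≤ u) (sym (ℕ.n∸n≡0 (8 + k))) z≤n))
  ...     | a ∷ rest | a∈@((_ , a≤) ∷ _) =
    let F , F∈ , u∈F = find (blocks-cover a∈ u (below-next (ℕ.≤-trans a≤ (ℕ.m≤n+m (4 + k) 3)) (ℕ.≰⇒> u≱′)))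
    in lose (∈BI′-blocks (a ∷ rest) F∈) u∈F

  vertexSet : ∀ {I} → AllIn n I → VertexSetIsV n (BI′ I)
  vertexSet I∈ v = (λ v∈ → let F , F∈ , v∈F = find v∈ in All.lookup (facet-in-V (isFacet I∈ F∈)) v∈F)
                 , V⊆vertices I∈ v

-- B(I) and -B(I) share no facet

∈-negate⁻ : ∀ {x G} → x ∈ map (λ z → ℤ.- z) G → ℤ.- x ∈ G
∈-negate⁻ {G = G} x∈ with y , y∈ , refl ← ∈-map⁻ (λ z → ℤ.- z) x∈ = subst (_∈ G) (sym (ℤ.neg-involutive y)) y∈

module Antipodal (k : ℕ) where
  open Facets k

  private
    ∋-1 : ∀ {G} → IsFacet G → -[1+ 0 ] ∈ G → G ≡ Fan 0 ⊎ ∃[ c ] G ≡ Block c 0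
    ∋-1 (isA _ _ _) -1∈ = ⊥-elim (∉⁴ (λ ()) (λ ()) (λ ()) (λ ()) -1∈)
    ∋-1 isS₀ -1∈ = ⊥-elim (∉⁴ (λ ()) (λ ()) (λ ()) (λ ()) -1∈)
    ∋-1 isS₁ -1∈ = ⊥-elim (∉⁴ (λ ()) (λ ()) (λ ()) (λ ()) -1∈)
    ∋-1 isS₂ -1∈ = ⊥-elim (∉⁴ (λ ()) (λ ()) (λ ()) (λ ()) -1∈)
    ∋-1 isS₃ -1∈ = ⊥-elim (∉⁴ (λ ()) (λ ()) (λ ()) (λ ()) -1∈)
    ∋-1 (isFan _ _) (here refl) = inj₁ refl
    ∋-1 (isFan _ _) (there (there (there (there ()))))
    ∋-1 (isHead _ () _) (there (here refl))
    ∋-1 (isHead _ _ _) (there (there (there (there ()))))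
    ∋-1 (isBlock c _ _ _ _) (here refl) = inj₂ (c , refl)
    ∋-1 (isBlock _ _ _ _ _) (there (there (there (there ()))))

    ∋2⇒positive : ∀ {F} → IsFacet F → + 2 ∈ F → ∀ u → -[1+ u ] ∉ F
    ∋2⇒positive (isA _ _ _) _ u = ∉⁴ (λ ()) (λ ()) (λ ()) (λ ())
    ∋2⇒positive isS₀ _ u = ∉⁴ (λ ()) (λ ()) (λ ()) (λ ())
    ∋2⇒positive isS₁ 2∈ u = ⊥-elim (∉⁴ (λ ()) (λ ()) (λ ()) (λ ()) 2∈)
    ∋2⇒positive isS₂ 2∈ u = ⊥-elim (∉⁴ (λ ()) (λ ()) (λ ()) (λ ()) 2∈)
    ∋2⇒positive isS₃ 2∈ u = ⊥-elim (∉⁴ (λ ()) (λ ()) (λ ()) (λ ()) 2∈)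
    ∋2⇒positive (isFan _ _) 2∈ u = ⊥-elim (∉⁴ (λ ()) (λ ()) (λ ()) (λ ()) 2∈)
    ∋2⇒positive (isHead _ () _ ) (there (there (here refl))) u
    ∋2⇒positive (isHead _ _ _) (there (there (there (there ())))) u
    ∋2⇒positive (isBlock _ _ () _ _) (there (there (here refl))) u
    ∋2⇒positive (isBlock _ _ _ _ _) (there (there (there (there ())))) u

    ∋-n⇒S₃ : ∀ {G} → IsFacet G → -[1+ 9 + k ] ∈ G → G ≡ S₃
    ∋-n⇒S₃ (isA _ _ _) -n∈ = ⊥-elim (∉⁴ (λ ()) (λ ()) (λ ()) (λ ()) -n∈)
    ∋-n⇒S₃ isS₀ -n∈ = ⊥-elim (∉⁴ (λ ()) (λ ()) (λ ()) (λ ()) -n∈)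
    ∋-n⇒S₃ isS₁ -n∈ = ⊥-elim (∉⁴ (λ ()) (λ ()) (λ ()) (λ ()) -n∈)
    ∋-n⇒S₃ isS₂ -n∈ = ⊥-elim (∉⁴ (λ ()) (λ ()) (λ ()) (λ ()) -n∈)
    ∋-n⇒S₃ isS₃ _ = refl
    ∋-n⇒S₃ (isFan _ s≤) (here refl) = ⊥-elim (1+d+n≰n 2 s≤)
    ∋-n⇒S₃ (isFan _ s≤) (there (here refl)) = ⊥-elim (1+d+n≰n 1 s≤)
    ∋-n⇒S₃ (isFan _ _) (there (there (there (there ()))))
    ∋-n⇒S₃ (isHead _ _ c≤) (there (here refl)) = ⊥-elim (1+d+n≰n 4 c≤)
    ∋-n⇒S₃ (isHead _ _ _) (there (there (there (there ()))))
    ∋-n⇒S₃ (isBlock _ _ _ c≤ s<c) (here refl) = ⊥-elim (1+d+n≰n 4 (ℕ.≤-trans (ℕ.<⇒≤ s<c) c≤))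
    ∋-n⇒S₃ (isBlock _ _ _ c≤ s<c) (there (here refl)) = ⊥-elim (1+d+n≰n 4 (ℕ.≤-trans s<c c≤))
    ∋-n⇒S₃ (isBlock _ _ _ _ _) (there (there (there (there ()))))

    ∋-[2+c]⇒∌-[4+c] : ∀ {G} c → c ≤ 4 + k → IsFacet G → -[1+ suc c ] ∈ G → -[1+ 3 + c ] ∉ G
    ∋-[2+c]⇒∌-[4+c] c c≤ (isA _ _ _) x∈ = ∉⁴ (λ ()) (λ ()) (λ ()) (λ ())
    ∋-[2+c]⇒∌-[4+c] c c≤ isS₀ x∈ = ∉⁴ (λ ()) (λ ()) (λ ()) (λ ())
    ∋-[2+c]⇒∌-[4+c] c c≤ isS₁ (there (here refl)) = ⊥-elim (1+d+n≰n 1 c≤)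
    ∋-[2+c]⇒∌-[4+c] c c≤ isS₁ (there (there (there (there ()))))
    ∋-[2+c]⇒∌-[4+c] c c≤ isS₂ (there (here refl)) = ⊥-elim (1+d+n≰n 1 c≤)
    ∋-[2+c]⇒∌-[4+c] c c≤ isS₂ (there (there (here refl))) = ⊥-elim (1+d+n≰n 2 c≤)
    ∋-[2+c]⇒∌-[4+c] c c≤ isS₂ (there (there (there (there ()))))
    ∋-[2+c]⇒∌-[4+c] c c≤ isS₃ (there (here refl)) = ⊥-elim (1+d+n≰n 1 c≤)
    ∋-[2+c]⇒∌-[4+c] c c≤ isS₃ (there (there (here refl))) = ⊥-elim (1+d+n≰n 2 c≤)
    ∋-[2+c]⇒∌-[4+c] c c≤ isS₃ (there (there (there (here refl)))) = ⊥-elim (1+d+n≰n 3 c≤)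
    ∋-[2+c]⇒∌-[4+c] c c≤ isS₃ (there (there (there (there ()))))
    ∋-[2+c]⇒∌-[4+c] c c≤ (isFan _ _) (here refl) = ∉⁴ (λ ()) (λ ()) (λ ()) (λ ())
    ∋-[2+c]⇒∌-[4+c] c c≤ (isFan _ _) (there (here refl)) = ∉⁴ (λ ()) (λ ()) (λ ()) (λ ())
    ∋-[2+c]⇒∌-[4+c] c c≤ (isFan _ _) (there (there (there (there ()))))
    ∋-[2+c]⇒∌-[4+c] c c≤ (isHead _ _ _) (there (here refl)) = ∉⁴ (λ ()) (λ ()) (λ ()) (λ ())
    ∋-[2+c]⇒∌-[4+c] c c≤ (isHead _ _ _) (there (there (there (there ()))))
    ∋-[2+c]⇒∌-[4+c] c c≤ (isBlock _ _ _ _ _) (here refl) = ∉⁴ (λ ()) (λ ()) (λ ()) (λ ())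
    ∋-[2+c]⇒∌-[4+c] c c≤ (isBlock _ _ _ _ _) (there (here refl)) = ∉⁴ (λ ()) (λ ()) (λ ()) (λ ())
    ∋-[2+c]⇒∌-[4+c] c c≤ (isBlock _ _ _ _ _) (there (there (there (there ()))))

    through-1 : ∀ {F G} → IsFacet F → IsFacet G → + 1 ∈ F →
                F ⊆ map (λ z → ℤ.- z) G → map (λ z → ℤ.- z) G ⊆ F → ⊥
    through-1 isF isG 1∈F F⊆-G -G⊆F with ∋-1 isG (∈-negate⁻ (F⊆-G 1∈F))
    ... | inj₁ refl = ∋2⇒positive isF (-G⊆F (there (here refl))) (8 + k) (-G⊆F (there (there (here refl))))
    ... | inj₂ (c , refl) = ∋2⇒positive isF (-G⊆F (there (here refl))) (suc c) (-G⊆F (there (there (here refl))))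

  -- A facet through 1 would need an antipode through -1, i.e. -Fan 0 or
  -- -Block c 0, which contain 2 together with a negative vertex.  Fan s
  -- contains n, so its antipode would be -S₃ ∋ n - 2; and Block c s would
  -- need an antipode through -(c + 2) and -(c + 4).
  no-antipodal-facets : ∀ {F G} → IsFacet F → IsFacet G →
                        F ⊆ map (λ z → ℤ.- z) G → map (λ z → ℤ.- z) G ⊆ F → ⊥
  no-antipodal-facets isF@(isA _ _ _) isG = through-1 isF isG (here refl)
  no-antipodal-facets isF@isS₀ isG = through-1 isF isG (here refl)
  no-antipodal-facets isF@isS₁ isG = through-1 isF isG (here refl)
  no-antipodal-facets isF@isS₂ isG = through-1 isF isG (here refl)
  no-antipodal-facets isF@isS₃ isG = through-1 isF isG (here refl)
  no-antipodal-facets isF@(isHead _ _ _) isG = through-1 isF isG (here refl)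
  no-antipodal-facets (isFan _ _) isG F⊆-G -G⊆F with ∋-n⇒S₃ isG (∈-negate⁻ (F⊆-G (there (there (there (here refl))))))
  ... | refl = ∉⁴ (λ ()) (λ ()) (λ ()) (λ ()) (-G⊆F (there (here refl)))
  no-antipodal-facets (isBlock c _ _ c≤ _) isG F⊆-G -G⊆F =
    ∋-[2+c]⇒∌-[4+c] c c≤ isG (∈-negate⁻ (F⊆-G (there (there (here refl))))) (∈-negate⁻ (F⊆-G (there (there (there (here refl))))))

-- A stacking order for the facets of B(I)

module Cofacets (k : ℕ) where
  open Facets k

  OnlyCofacet : ℤ → ℤ → ℤ → Face → ℤ → Set
  OnlyCofacet a b c T d = ∀ {G} → IsFacet G → a ∈ G → b ∈ G → c ∈ G → G ≡ T ⊎ d ∈ G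

  only-S₀⊇12n : OnlyCofacet (+ 1) (+ 2) (+ (10 + k)) S₀ (+ (8 + k))
  only-S₀⊇12n (isA _ _ i≤) _ _ (there (there (here refl))) = ⊥-elim (1+d+n≰n 1 i≤)
  only-S₀⊇12n (isA _ _ _) _ _ (there (there (there (here refl)))) = inj₂ (there (there (here refl)))
  only-S₀⊇12n (isA _ _ _) _ _ (there (there (there (there ()))))
  only-S₀⊇12n isS₀ _ _ _ = inj₁ refl
  only-S₀⊇12n isS₁ _ 2∈ _ = ⊥-elim (∉⁴ (λ ()) (λ ()) (λ ()) (λ ()) 2∈)
  only-S₀⊇12n isS₂ _ 2∈ _ = ⊥-elim (∉⁴ (λ ()) (λ ()) (λ ()) (λ ()) 2∈)
  only-S₀⊇12n isS₃ _ 2∈ _ = ⊥-elim (∉⁴ (λ ()) (λ ()) (λ ()) (λ ()) 2∈)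
  only-S₀⊇12n (isFan _ _) 1∈ _ _ = ⊥-elim (∉⁴ (λ ()) (λ ()) (λ ()) (λ ()) 1∈)
  only-S₀⊇12n (isHead _ () _) _ (there (there (here refl))) _
  only-S₀⊇12n (isHead _ _ _) _ (there (there (there (there ())))) _
  only-S₀⊇12n (isBlock _ _ _ _ _) 1∈ _ _ = ⊥-elim (∉⁴ (λ ()) (λ ()) (λ ()) (λ ()) 1∈)

  only-S₀⊇12n-1 : OnlyCofacet (+ 1) (+ 2) (+ (9 + k)) S₀ (+ (7 + k))
  only-S₀⊇12n-1 (isA _ _ i≤) _ _ (there (there (here refl))) = ⊥-elim (1+d+n≰n 0 i≤)
  only-S₀⊇12n-1 (isA _ _ _) _ _ (there (there (there (here refl)))) = inj₂ (there (there (here refl)))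
  only-S₀⊇12n-1 (isA _ _ _) _ _ (there (there (there (there ()))))
  only-S₀⊇12n-1 isS₀ _ _ _ = inj₁ refl
  only-S₀⊇12n-1 isS₁ _ 2∈ _ = ⊥-elim (∉⁴ (λ ()) (λ ()) (λ ()) (λ ()) 2∈)
  only-S₀⊇12n-1 isS₂ _ 2∈ _ = ⊥-elim (∉⁴ (λ ()) (λ ()) (λ ()) (λ ()) 2∈)
  only-S₀⊇12n-1 isS₃ _ 2∈ _ = ⊥-elim (∉⁴ (λ ()) (λ ()) (λ ()) (λ ()) 2∈)
  only-S₀⊇12n-1 (isFan _ _) 1∈ _ _ = ⊥-elim (∉⁴ (λ ()) (λ ()) (λ ()) (λ ()) 1∈)
  only-S₀⊇12n-1 (isHead _ () _) _ (there (there (here refl))) _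
  only-S₀⊇12n-1 (isHead _ _ _) _ (there (there (there (there ())))) _
  only-S₀⊇12n-1 (isBlock _ _ _ _ _) 1∈ _ _ = ⊥-elim (∉⁴ (λ ()) (λ ()) (λ ()) (λ ()) 1∈)

  only-A⊇12 : ∀ y → 3 + y ≤ 6 + k → OnlyCofacet (+ 1) (+ 2) (+ (5 + y)) (A (5 + y)) (+ (3 + y))
  only-A⊇12 y y≤ (isA _ _ _) _ _ (there (there (here refl))) = inj₁ refl
  only-A⊇12 y y≤ (isA _ _ _) _ _ (there (there (there (here refl)))) = inj₂ (there (there (here refl)))
  only-A⊇12 y y≤ (isA _ _ _) _ _ (there (there (there (there ()))))
  only-A⊇12 y y≤ isS₀ _ _ (there (there (here refl))) = ⊥-elim (1+d+n≰n 0 y≤)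
  only-A⊇12 y y≤ isS₀ _ _ (there (there (there (here refl)))) = ⊥-elim (1+d+n≰n 1 y≤)
  only-A⊇12 y y≤ isS₀ _ _ (there (there (there (there ()))))
  only-A⊇12 y y≤ isS₁ _ 2∈ _ = ⊥-elim (∉⁴ (λ ()) (λ ()) (λ ()) (λ ()) 2∈)
  only-A⊇12 y y≤ isS₂ _ 2∈ _ = ⊥-elim (∉⁴ (λ ()) (λ ()) (λ ()) (λ ()) 2∈)
  only-A⊇12 y y≤ isS₃ _ 2∈ _ = ⊥-elim (∉⁴ (λ ()) (λ ()) (λ ()) (λ ()) 2∈)
  only-A⊇12 y y≤ (isFan _ _) 1∈ _ _ = ⊥-elim (∉⁴ (λ ()) (λ ()) (λ ()) (λ ()) 1∈)
  only-A⊇12 y y≤ (isHead _ () _) _ (there (there (here refl))) _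
  only-A⊇12 y y≤ (isHead _ _ _) _ (there (there (there (there ())))) _
  only-A⊇12 y y≤ (isBlock _ _ _ _ _) 1∈ _ _ = ⊥-elim (∉⁴ (λ ()) (λ ()) (λ ()) (λ ()) 1∈)

  only-S₀⊇1n : OnlyCofacet (+ 1) (+ (9 + k)) (+ (10 + k)) S₀ -[1+ 7 + k ]
  only-S₀⊇1n (isA _ _ i≤) _ (there (there (here refl))) _ = ⊥-elim (1+d+n≰n 0 i≤)
  only-S₀⊇1n (isA _ _ _) _ (there (there (there (here refl)))) n∈ = ⊥-elim (∉⁴ (λ ()) (λ ()) (λ ()) (λ ()) n∈)
  only-S₀⊇1n (isA _ _ _) _ (there (there (there (there ())))) _
  only-S₀⊇1n isS₀ _ _ _ = inj₁ refl
  only-S₀⊇1n isS₁ _ _ _ = inj₂ (there (here refl))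
  only-S₀⊇1n isS₂ _ n-1∈ _ = ⊥-elim (∉⁴ (λ ()) (λ ()) (λ ()) (λ ()) n-1∈)
  only-S₀⊇1n isS₃ _ n-1∈ _ = ⊥-elim (∉⁴ (λ ()) (λ ()) (λ ()) (λ ()) n-1∈)
  only-S₀⊇1n (isFan _ _) 1∈ _ _ = ⊥-elim (∉⁴ (λ ()) (λ ()) (λ ()) (λ ()) 1∈)
  only-S₀⊇1n (isHead _ _ c≤) _ (there (there (here refl))) _ = ⊥-elim (1+d+n≰n 2 c≤)
  only-S₀⊇1n (isHead _ _ c≤) _ (there (there (there (here refl)))) _ = ⊥-elim (1+d+n≰n 0 c≤)
  only-S₀⊇1n (isHead _ _ _) _ (there (there (there (there ())))) _
  only-S₀⊇1n (isBlock _ _ _ _ _) 1∈ _ _ = ⊥-elim (∉⁴ (λ ()) (λ ()) (λ ()) (λ ()) 1∈)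

  only-S₁⊇1n : OnlyCofacet (+ 1) -[1+ 7 + k ] (+ (10 + k)) S₁ -[1+ 8 + k ]
  only-S₁⊇1n (isA _ _ _) _ -∈ _ = ⊥-elim (∉⁴ (λ ()) (λ ()) (λ ()) (λ ()) -∈)
  only-S₁⊇1n isS₀ _ -∈ _ = ⊥-elim (∉⁴ (λ ()) (λ ()) (λ ()) (λ ()) -∈)
  only-S₁⊇1n isS₁ _ _ _ = inj₁ refl
  only-S₁⊇1n isS₂ _ _ _ = inj₂ (there (there (here refl)))
  only-S₁⊇1n isS₃ _ _ n∈ = ⊥-elim (∉⁴ (λ ()) (λ ()) (λ ()) (λ ()) n∈)
  only-S₁⊇1n (isFan _ _) 1∈ _ _ = ⊥-elim (∉⁴ (λ ()) (λ ()) (λ ()) (λ ()) 1∈)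
  only-S₁⊇1n (isHead _ _ c≤) _ (there (here refl)) _ = ⊥-elim (1+d+n≰n 2 c≤)
  only-S₁⊇1n (isHead _ _ _) _ (there (there (there (there ())))) _
  only-S₁⊇1n (isBlock _ _ _ _ _) 1∈ _ _ = ⊥-elim (∉⁴ (λ ()) (λ ()) (λ ()) (λ ()) 1∈)

  only-S₂⊇1 : OnlyCofacet (+ 1) -[1+ 7 + k ] -[1+ 8 + k ] S₂ -[1+ 9 + k ]
  only-S₂⊇1 (isA _ _ _) _ -∈ _ = ⊥-elim (∉⁴ (λ ()) (λ ()) (λ ()) (λ ()) -∈)
  only-S₂⊇1 isS₀ _ -∈ _ = ⊥-elim (∉⁴ (λ ()) (λ ()) (λ ()) (λ ()) -∈)
  only-S₂⊇1 isS₁ _ _ -∈ = ⊥-elim (∉⁴ (λ ()) (λ ()) (λ ()) (λ ()) -∈)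
  only-S₂⊇1 isS₂ _ _ _ = inj₁ refl
  only-S₂⊇1 isS₃ _ _ _ = inj₂ (there (there (there (here refl))))
  only-S₂⊇1 (isFan _ _) 1∈ _ _ = ⊥-elim (∉⁴ (λ ()) (λ ()) (λ ()) (λ ()) 1∈)
  only-S₂⊇1 (isHead _ _ c≤) _ (there (here refl)) _ = ⊥-elim (1+d+n≰n 2 c≤)
  only-S₂⊇1 (isHead _ _ _) _ (there (there (there (there ())))) _
  only-S₂⊇1 (isBlock _ _ _ _ _) 1∈ _ _ = ⊥-elim (∉⁴ (λ ()) (λ ()) (λ ()) (λ ()) 1∈)

  only-S₁⊇n : OnlyCofacet -[1+ 7 + k ] (+ (9 + k)) (+ (10 + k)) S₁ -[1+ 6 + k ]
  only-S₁⊇n (isA _ _ _) -∈ _ _ = ⊥-elim (∉⁴ (λ ()) (λ ()) (λ ()) (λ ()) -∈)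
  only-S₁⊇n isS₀ -∈ _ _ = ⊥-elim (∉⁴ (λ ()) (λ ()) (λ ()) (λ ()) -∈)
  only-S₁⊇n isS₁ _ _ _ = inj₁ refl
  only-S₁⊇n isS₂ _ n-1∈ _ = ⊥-elim (∉⁴ (λ ()) (λ ()) (λ ()) (λ ()) n-1∈)
  only-S₁⊇n isS₃ _ n-1∈ _ = ⊥-elim (∉⁴ (λ ()) (λ ()) (λ ()) (λ ()) n-1∈)
  only-S₁⊇n (isFan _ s≤) (here refl) _ _ = ⊥-elim (1+d+n≰n 0 s≤)
  only-S₁⊇n (isFan _ _) (there (here refl)) _ _ = inj₂ (here refl)
  only-S₁⊇n (isFan _ _) (there (there (there (there ())))) _ _
  only-S₁⊇n (isHead _ _ c≤) _ (there (there (here refl))) _ = ⊥-elim (1+d+n≰n 2 c≤)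
  only-S₁⊇n (isHead _ _ c≤) _ (there (there (there (here refl)))) _ = ⊥-elim (1+d+n≰n 0 c≤)
  only-S₁⊇n (isHead _ _ _) _ (there (there (there (there ())))) _
  only-S₁⊇n (isBlock _ _ _ c≤ _) _ (there (there (here refl))) _ = ⊥-elim (1+d+n≰n 2 c≤)
  only-S₁⊇n (isBlock _ _ _ c≤ _) _ (there (there (there (here refl)))) _ = ⊥-elim (1+d+n≰n 0 c≤)
  only-S₁⊇n (isBlock _ _ _ _ _) _ (there (there (there (there ())))) _

  only-Fan⊇n : ∀ y → suc y ≤ 6 + k → OnlyCofacet -[1+ suc y ] (+ (9 + k)) (+ (10 + k)) (Fan (suc y)) -[1+ y ]
  only-Fan⊇n y y< (isA _ _ _) -∈ _ _ = ⊥-elim (∉⁴ (λ ()) (λ ()) (λ ()) (λ ()) -∈)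
  only-Fan⊇n y y< isS₀ -∈ _ _ = ⊥-elim (∉⁴ (λ ()) (λ ()) (λ ()) (λ ()) -∈)
  only-Fan⊇n y y< isS₁ (there (here refl)) _ _ = ⊥-elim (1+d+n≰n 0 y<)
  only-Fan⊇n y y< isS₁ (there (there (there (there ())))) _ _
  only-Fan⊇n y y< isS₂ _ n-1∈ _ = ⊥-elim (∉⁴ (λ ()) (λ ()) (λ ()) (λ ()) n-1∈)
  only-Fan⊇n y y< isS₃ _ n-1∈ _ = ⊥-elim (∉⁴ (λ ()) (λ ()) (λ ()) (λ ()) n-1∈)
  only-Fan⊇n y y< (isFan _ _) (here refl) _ _ = inj₁ refl
  only-Fan⊇n y y< (isFan _ _) (there (here refl)) _ _ = inj₂ (here refl)
  only-Fan⊇n y y< (isFan _ _) (there (there (there (there ())))) _ _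
  only-Fan⊇n y y< (isHead _ _ c≤) _ (there (there (here refl))) _ = ⊥-elim (1+d+n≰n 2 c≤)
  only-Fan⊇n y y< (isHead _ _ c≤) _ (there (there (there (here refl)))) _ = ⊥-elim (1+d+n≰n 0 c≤)
  only-Fan⊇n y y< (isHead _ _ _) _ (there (there (there (there ())))) _
  only-Fan⊇n y y< (isBlock _ _ _ c≤ _) _ (there (there (here refl))) _ = ⊥-elim (1+d+n≰n 2 c≤)
  only-Fan⊇n y y< (isBlock _ _ _ c≤ _) _ (there (there (there (here refl)))) _ = ⊥-elim (1+d+n≰n 0 c≤)
  only-Fan⊇n y y< (isBlock _ _ _ _ _) _ (there (there (there (there ())))) _

  only-A⊇1 : ∀ c → 3 ≤ c → c ≤ 4 + k → OnlyCofacet (+ 1) (+ (2 + c)) (+ (4 + c)) (A (2 + c)) -[1+ c ]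
  only-A⊇1 c () c≤ (isA _ _ _) _ (there (here refl)) _
  only-A⊇1 c 3≤c c≤ (isA _ _ _) _ (there (there (here refl))) _ = inj₁ refl
  only-A⊇1 c 3≤c c≤ (isA _ _ _) _ (there (there (there (here refl)))) 4+c∈ = ⊥-elim (∉⁴ (λ ()) (λ ()) (λ ()) (λ ()) 4+c∈)
  only-A⊇1 c 3≤c c≤ (isA _ _ _) _ (there (there (there (there ())))) _
  only-A⊇1 c () c≤ isS₀ _ (there (here refl)) _
  only-A⊇1 c 3≤c c≤ isS₀ _ (there (there (here refl))) _ = ⊥-elim (1+d+n≰n 2 c≤)
  only-A⊇1 c 3≤c c≤ isS₀ _ (there (there (there (here refl)))) _ = ⊥-elim (1+d+n≰n 3 c≤)
  only-A⊇1 c 3≤c c≤ isS₀ _ (there (there (there (there ())))) _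
  only-A⊇1 c 3≤c c≤ isS₁ _ (there (there (here refl))) _ = ⊥-elim (1+d+n≰n 2 c≤)
  only-A⊇1 c 3≤c c≤ isS₁ _ (there (there (there (here refl)))) _ = ⊥-elim (1+d+n≰n 3 c≤)
  only-A⊇1 c 3≤c c≤ isS₁ _ (there (there (there (there ())))) _
  only-A⊇1 c 3≤c c≤ isS₂ _ (there (there (there (here refl)))) _ = ⊥-elim (1+d+n≰n 3 c≤)
  only-A⊇1 c 3≤c c≤ isS₂ _ (there (there (there (there ())))) _
  only-A⊇1 c 3≤c c≤ isS₃ _ 2+c∈ _ = ⊥-elim (∉⁴ (λ ()) (λ ()) (λ ()) (λ ()) 2+c∈)
  only-A⊇1 c 3≤c c≤ (isFan _ _) 1∈ _ _ = ⊥-elim (∉⁴ (λ ()) (λ ()) (λ ()) (λ ()) 1∈)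
  only-A⊇1 c 3≤c c≤ (isHead _ _ _) _ (there (there (here refl))) _ = inj₂ (there (here refl))
  only-A⊇1 c 3≤c c≤ (isHead _ _ _) _ (there (there (there (here refl)))) 4+c∈ = ⊥-elim (∉⁴ (λ ()) (λ ()) (λ ()) (λ ()) 4+c∈)
  only-A⊇1 c 3≤c c≤ (isHead _ _ _) _ (there (there (there (there ())))) _
  only-A⊇1 c 3≤c c≤ (isBlock _ _ _ _ _) 1∈ _ _ = ⊥-elim (∉⁴ (λ ()) (λ ()) (λ ()) (λ ()) 1∈)

  only-Head⊇ : ∀ y → suc y ≤ 4 + k → OnlyCofacet -[1+ suc y ] (+ (3 + y)) (+ (5 + y)) (Head (suc y)) -[1+ y ]
  only-Head⊇ y y< (isA _ _ _) -∈ _ _ = ⊥-elim (∉⁴ (λ ()) (λ ()) (λ ()) (λ ()) -∈)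
  only-Head⊇ y y< isS₀ -∈ _ _ = ⊥-elim (∉⁴ (λ ()) (λ ()) (λ ()) (λ ()) -∈)
  only-Head⊇ y y< isS₁ _ (there (there (here refl))) _ = ⊥-elim (1+d+n≰n 2 y<)
  only-Head⊇ y y< isS₁ _ (there (there (there (here refl)))) _ = ⊥-elim (1+d+n≰n 3 y<)
  only-Head⊇ y y< isS₁ _ (there (there (there (there ())))) _
  only-Head⊇ y y< isS₂ _ (there (there (there (here refl)))) _ = ⊥-elim (1+d+n≰n 3 y<)
  only-Head⊇ y y< isS₂ _ (there (there (there (there ())))) _
  only-Head⊇ y y< isS₃ _ 3+y∈ _ = ⊥-elim (∉⁴ (λ ()) (λ ()) (λ ()) (λ ()) 3+y∈)
  only-Head⊇ y y< (isFan _ _) _ (there (there (here refl))) _ = ⊥-elim (1+d+n≰n 2 y<)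
  only-Head⊇ y y< (isFan _ _) _ (there (there (there (here refl)))) _ = ⊥-elim (1+d+n≰n 3 y<)
  only-Head⊇ y y< (isFan _ _) _ (there (there (there (there ())))) _
  only-Head⊇ y y< (isHead _ _ _) (there (here refl)) _ _ = inj₁ refl
  only-Head⊇ y y< (isHead _ _ _) (there (there (there (there ())))) _ _
  only-Head⊇ y y< (isBlock _ _ _ _ s<c) (here refl) (there (there (here refl))) _ = ⊥-elim (ℕ.<-irrefl refl s<c)
  only-Head⊇ y y< (isBlock _ _ _ _ _) (there (here refl)) (there (there (here refl))) _ = inj₂ (here refl)
  only-Head⊇ y y< (isBlock _ _ _ _ _) (there (there (there (there ())))) (there (there (here refl))) _
  only-Head⊇ y y< (isBlock _ _ _ _ _) _ (there (there (there (here refl)))) 5+y∈ = ⊥-elim (∉⁴ (λ ()) (λ ()) (λ ()) (λ ()) 5+y∈)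
  only-Head⊇ y y< (isBlock _ _ _ _ _) _ (there (there (there (there ())))) _

  only-Block⊇ : ∀ c y → 2 + y ≤ c → c ≤ 4 + k →
                OnlyCofacet -[1+ suc y ] (+ (2 + c)) (+ (4 + c)) (Block c (suc y)) -[1+ y ]
  only-Block⊇ c y y< c≤ (isA _ _ _) -∈ _ _ = ⊥-elim (∉⁴ (λ ()) (λ ()) (λ ()) (λ ()) -∈)
  only-Block⊇ c y y< c≤ isS₀ -∈ _ _ = ⊥-elim (∉⁴ (λ ()) (λ ()) (λ ()) (λ ()) -∈)
  only-Block⊇ c y y< c≤ isS₁ _ (there (there (here refl))) _ = ⊥-elim (1+d+n≰n 2 c≤)
  only-Block⊇ c y y< c≤ isS₁ _ (there (there (there (here refl)))) _ = ⊥-elim (1+d+n≰n 3 c≤)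
  only-Block⊇ c y y< c≤ isS₁ _ (there (there (there (there ())))) _
  only-Block⊇ c y y< c≤ isS₂ _ (there (there (there (here refl)))) _ = ⊥-elim (1+d+n≰n 3 c≤)
  only-Block⊇ c y y< c≤ isS₂ _ (there (there (there (there ())))) _
  only-Block⊇ c y y< c≤ isS₃ _ 2+c∈ _ = ⊥-elim (∉⁴ (λ ()) (λ ()) (λ ()) (λ ()) 2+c∈)
  only-Block⊇ c y y< c≤ (isFan _ _) _ (there (there (here refl))) _ = ⊥-elim (1+d+n≰n 2 c≤)
  only-Block⊇ c y y< c≤ (isFan _ _) _ (there (there (there (here refl)))) _ = ⊥-elim (1+d+n≰n 3 c≤)
  only-Block⊇ c y y< c≤ (isFan _ _) _ (there (there (there (there ())))) _
  only-Block⊇ c y y< c≤ (isHead _ _ _) (there (here refl)) (there (there (here refl))) _ = ⊥-elim (1+d+n≰n 0 y<)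
  only-Block⊇ c y y< c≤ (isHead _ _ _) (there (there (there (there ())))) (there (there (here refl))) _
  only-Block⊇ c y y< c≤ (isHead _ _ _) _ (there (there (there (here refl)))) 4+c∈ = ⊥-elim (∉⁴ (λ ()) (λ ()) (λ ()) (λ ()) 4+c∈)
  only-Block⊇ c y y< c≤ (isHead _ _ _) _ (there (there (there (there ())))) _
  only-Block⊇ c y y< c≤ (isBlock _ _ _ _ _) (here refl) (there (there (here refl))) _ = inj₁ refl
  only-Block⊇ c y y< c≤ (isBlock _ _ _ _ _) (there (here refl)) (there (there (here refl))) _ = inj₂ (here refl)
  only-Block⊇ c y y< c≤ (isBlock _ _ _ _ _) (there (there (there (there ())))) (there (there (here refl))) _
  only-Block⊇ c y y< c≤ (isBlock _ _ _ _ _) _ (there (there (there (here refl)))) 4+c∈ = ⊥-elim (∉⁴ (λ ()) (λ ()) (λ ()) (λ ()) 4+c∈)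
  only-Block⊇ c y y< c≤ (isBlock _ _ _ _ _) _ (there (there (there (there ())))) _

interval : ℕ → ℕ → List ℕ
interval a zero = []
interval a (suc l) = a ∷ interval (suc a) l

range≡interval : ∀ a b → range a b ≡ interval a (suc b ∸ a)
range≡interval a b = ≡-trans (map-upTo (λ i → a + i) (suc b ∸ a)) (applyUpTo≡interval a (suc b ∸ a) λ _ → refl)
  where
  applyUpTo≡interval : ∀ {f} a l → (∀ i → f i ≡ a + i) → applyUpTo f l ≡ interval a l
  applyUpTo≡interval a zero _ = refl
  applyUpTo≡interval a (suc l) f≡ = cong₂ _∷_ (≡-trans (f≡ 0) (ℕ.+-identityʳ a))
    (applyUpTo≡interval (suc a) l λ i → ≡-trans (f≡ (suc i)) (ℕ.+-suc a i))

StackingSequence-interval : (f : ℕ → Face) (Q : ℕ → Complex → Set) {hi : ℕ} →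
  (∀ {m K} → m ≤ hi → Q m K → Stacking K (f m) × Q (suc m) (K ++ [ f m ])) →
  ∀ l a {K} → a + l ≤ suc hi → Q a K → StackingSequence K (map f (interval a l)) × Q (a + l) (K ++ map f (interval a l))
StackingSequence-interval f Q step zero a {K} _ q = tt , subst₂ Q (sym (ℕ.+-identityʳ a)) (sym (++-identityʳ K)) q
StackingSequence-interval f Q {hi} step (suc l) a {K} a+l< q with S , q′ ← step (ℕ.≤-pred (ℕ.≤-trans (s≤s (ℕ.m≤m+n a l)) (subst (_≤ suc hi) (ℕ.+-suc a l) a+l<))) q
  with seq , q″ ← StackingSequence-interval f Q step l (suc a) (subst (_≤ suc hi) (ℕ.+-suc a l) a+l<) q′ =
  (S , seq) , subst₂ Q (sym (ℕ.+-suc a l)) (++-assoc K [ f a ] (map f (interval (suc a) l))) q″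

StackingSequence-range : (f : ℕ → Face) (Q : ℕ → Complex → Set) {hi : ℕ} →
  (∀ {m K} → m ≤ hi → Q m K → Stacking K (f m) × Q (suc m) (K ++ [ f m ])) →
  ∀ a {K} → a ≤ suc hi → Q a K → StackingSequence K (map f (range a hi)) × Q (suc hi) (K ++ map f (range a hi))
StackingSequence-range f Q {hi} step a {K} a≤ q =
  subst (λ L → StackingSequence K (map f L) × Q (suc hi) (K ++ map f L)) (sym (range≡interval a hi))
    (subst (λ m → StackingSequence K (map f (interval a (suc hi ∸ a))) × Q m (K ++ map f (interval a (suc hi ∸ a)))) a+l≡
      (StackingSequence-interval f Q step (suc hi ∸ a) a (ℕ.≤-reflexive a+l≡) q))
  where
  a+l≡ : a + (suc hi ∸ a) ≡ suc hi
  a+l≡ = ℕ.m+[n∸m]≡n a≤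

module BIStacking (k : ℕ) where
  open Facets k
  open Cofacets k
  open Vertices k using (facet-in-V)

  AllFacets : Complex → Set
  AllFacets = All IsFacet

  VerticesIn : (ℤ → Set) → Complex → Set
  VerticesIn P = All (All P)

  private
    spare-fresh : ∀ {K} → AllFacets K → ¬ IsVertex (+ (11 + k)) K
    spare-fresh facets w∈K with G , G∈ , w∈G ← find w∈K =
      1+d+n≰n 0 (proj₂ (All.lookup (facet-in-V (All.lookup facets G∈)) w∈G))

    ∉-by : ∀ {P K d} → VerticesIn P K → ¬ P d → ∀ {G} → G ∈ K → d ∉ G
    ∉-by vertices ¬Pd G∈ d∈G = ¬Pd (All.lookup (All.lookup vertices G∈) d∈G)

    _∷ᴬ_ : ∀ {P K F} → VerticesIn P K → All P F → VerticesIn P (K ++ [ F ])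
    vertices ∷ᴬ new = ++⁺ vertices (new ∷ [])

    weaken : ∀ {P Q : ℤ → Set} {K} → (∀ {v} → P v → Q v) → VerticesIn P K → VerticesIn Q K
    weaken P⇒Q = All.map (All.map P⇒Q)

  stacking : ∀ {K F} a b c e d T → AllFacets K → IsFacet F → T ∈ K → T ≈ e ∷ a ∷ b ∷ c ∷ [] →
             e ∉ a ∷ b ∷ c ∷ [] → F ≈ d ∷ a ∷ b ∷ c ∷ [] → (∀ {G} → G ∈ K → d ∉ G) →
             a ≢ b → a ≢ c → b ≢ c → OnlyCofacet a b c T d → Stacking K F
  stacking {K} a b c e d T facets isF T∈K T≈ e∉ F≈ d∉K a≢b a≢c b≢c only = record
    { a = a ; b = b ; c = c ; d = d ; e = e ; w = + (11 + k) ; cofacet = T ; cofacet∈K = T∈K ; cofacet≈ = T≈ ; e∉abc = e∉ ; F≈ = F≈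
    ; d-fresh = λ d∈K → let G , G∈ , d∈G = find d∈K in d∉K G∈ d∈G
    ; w-fresh = spare-fresh facets
    ; w≢d = λ { refl → spare-fresh (isF ∷ []) (here (proj₂ F≈ (here refl))) }
    ; a≢b = a≢b ; a≢c = a≢c ; b≢c = b≢c
    ; cofacet-unique = λ {G} G∈K abc⊆G → unique G∈K (only (All.lookup facets G∈K) (abc⊆G (here refl))
                                                 (abc⊆G (there (here refl))) (abc⊆G (there (there (here refl))))) }
    where
    unique : ∀ {G} → G ∈ K → G ≡ T ⊎ d ∈ G → G ≈ T
    unique _ (inj₁ refl) = ≈-refl
    unique G∈K (inj₂ d∈G) = ⊥-elim (d∉K G∈K d∈G)

  AVertex : ℕ → ℤ → Set
  AVertex x v = v ≡ + 1 ⊎ v ≡ + 2 ⊎ ∃[ p ] v ≡ + p × 3 + x ≤ p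

  record APhase (x : ℕ) (K : Complex) : Set where
    field
      x≤ : x ≤ 6 + k
      facets : AllFacets K
      vertices : VerticesIn (AVertex x) K
      S₀∈ : S₀ ∈ K
      A∈ : ∀ i → 3 + x ≤ i → i ≤ 8 + k → A i ∈ K

  private
    3+x-fresh : ∀ {x} → ¬ AVertex (suc x) (+ (3 + x))
    3+x-fresh (inj₂ (inj₂ (_ , refl , 4+x≤))) = 1+d+n≰n 0 4+x≤

    A-stacking : ∀ x {K} → APhase (suc x) K → Stacking K (A (3 + x))
    A-stacking x {K} inv with ℕ.m≤n⇒m<n∨m≡n (ℕ.≤-pred x≤)
      where open APhase inv
    ... | inj₂ refl = stacking (+ 1) (+ 2) (+ (10 + k)) (+ (9 + k)) (+ (8 + k)) S₀ facets (isA _ (s≤s (s≤s (s≤s z≤n))) ℕ.≤-refl)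
      S₀∈ (≈-bring (+ 1 ∷ + 2 ∷ [])) (∉³ (λ ()) (λ ()) (λ ())) (≈-bring (+ 1 ∷ + 2 ∷ [])) (∉-by vertices 3+x-fresh)
      (λ ()) (λ ()) (λ ()) only-S₀⊇12n
      where open APhase inv
    ... | inj₁ x<5+k with ℕ.m≤n⇒m<n∨m≡n (ℕ.≤-pred x<5+k)
    ...   | inj₂ refl = stacking (+ 1) (+ 2) (+ (9 + k)) (+ (10 + k)) (+ (7 + k)) S₀ facets (isA _ (s≤s (s≤s (s≤s z≤n))) (ℕ.n≤1+n _))
      S₀∈ (≈-bring (+ 1 ∷ + 2 ∷ + (9 + k) ∷ [])) (∉³ (λ ()) (λ ()) (λ ())) (≈-bring (+ 1 ∷ + 2 ∷ [])) (∉-by vertices 3+x-fresh)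
      (λ ()) (λ ()) (λ ()) only-S₀⊇12n-1
      where open APhase inv
    ...   | inj₁ x<4+k = stacking (+ 1) (+ 2) (+ (5 + x)) (+ (7 + x)) (+ (3 + x)) (A (5 + x)) facets
      (isA _ (s≤s (s≤s (s≤s z≤n))) (ℕ.≤-trans (s≤s (s≤s x<4+k)) (ℕ.m≤n+m _ 2)))
      (A∈ (5 + x) (ℕ.n≤1+n _) (s≤s (s≤s (s≤s (s≤s x<4+k)))))
      (≈-bring (+ 1 ∷ + 2 ∷ + (5 + x) ∷ [])) (∉³ (λ ()) (λ ()) (λ ())) (≈-bring (+ 1 ∷ + 2 ∷ [])) (∉-by vertices 3+x-fresh)
      (λ ()) (λ ()) (λ ()) (only-A⊇12 x (s≤s (s≤s x<4+k)))
      where open APhase inv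

    A-step : ∀ x {K} → APhase (suc x) K → APhase x (K ++ [ A (3 + x) ])
    A-step x {K} inv = record
      { x≤ = ℕ.≤-trans (ℕ.n≤1+n x) x≤
      ; facets = ++⁺ facets (isA (3 + x) (s≤s (s≤s (s≤s z≤n))) (s≤s (s≤s (s≤s (ℕ.≤-pred x≤)))) ∷ [])
      ; vertices = weaken later vertices ∷ᴬ (inj₁ refl ∷ inj₂ (inj₁ refl) ∷ inj₂ (inj₂ (_ , refl , ℕ.≤-refl))
                                          ∷ inj₂ (inj₂ (_ , refl , ℕ.m≤n+m _ 2)) ∷ [])
      ; S₀∈ = ∈-++⁺ˡ S₀∈
      ; A∈ = A∈′ }
      where
      open APhase inv
      later : ∀ {v} → AVertex (suc x) v → AVertex x v
      later (inj₂ (inj₂ (p , refl , 4+x≤p))) = inj₂ (inj₂ (p , refl , ℕ.≤-trans (ℕ.n≤1+n _) 4+x≤p))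
      later (inj₁ v≡1) = inj₁ v≡1
      later (inj₂ (inj₁ v≡2)) = inj₂ (inj₁ v≡2)
      A∈′ : ∀ i → 3 + x ≤ i → i ≤ 8 + k → A i ∈ K ++ [ A (3 + x) ]
      A∈′ i 3+x≤i i≤ with ℕ.m≤n⇒m<n∨m≡n 3+x≤i
      ... | inj₂ refl = ∈-++⁺ʳ K (here refl)
      ... | inj₁ 3+x<i = ∈-++⁺ˡ (A∈ i 3+x<i i≤)

  A-phase : List Face
  A-phase = map (λ x → A (3 + x)) (downFrom (6 + k))

  stack-A : ∀ x {K} → APhase x K →
            StackingSequence K (map (λ x → A (3 + x)) (downFrom x)) × APhase 0 (K ++ map (λ x → A (3 + x)) (downFrom x))
  stack-A zero {K} inv = tt , subst (APhase 0) (sym (++-identityʳ K)) inv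
  stack-A (suc x) {K} inv with seq , inv′ ← stack-A x (A-step x inv) =
    (A-stacking x inv , seq) , subst (APhase 0) (++-assoc K [ A (3 + x) ] _) inv′

  Positive : ℤ → Set
  Positive v = ∃[ p ] v ≡ + p

  NegVertex : ℕ → ℤ → Set
  NegVertex m v = Positive v ⊎ (∃[ u ] v ≡ -[1+ u ] × 9 + k ≤ u + m)

  record FanPhase (m : ℕ) (K : Complex) : Set where
    field
      facets : AllFacets K
      vertices : VerticesIn (NegVertex m) K
      S₁∈ : S₁ ∈ K
      A∈ : ∀ i → 3 ≤ i → i ≤ 8 + k → A i ∈ K
      previous : m ≡ 2 ⊎ ∃[ m′ ] m ≡ suc m′ × 2 ≤ m′ × Fan′ m′ ∈ K

  S-phase : List Face
  S-phase = S₁ ∷ S₂ ∷ S₃ ∷ []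

  stack-S : ∀ {K} → APhase 0 K → StackingSequence K S-phase × FanPhase 2 (K ++ S-phase)
  stack-S {K} inv =
    ( stacking (+ 1) (+ (9 + k)) (+ (10 + k)) (+ 2) -[1+ 7 + k ] S₀ facets isS₁ S₀∈
        (≈-bring (+ 1 ∷ [])) (∉³ (λ ()) (λ ()) (λ ())) (≈-bring (+ 1 ∷ []))
        (∉-by vertices λ { (inj₁ ()) ; (inj₂ (inj₁ ())) ; (inj₂ (inj₂ (_ , () , _))) }) (λ ()) (λ ()) (λ ()) only-S₀⊇1n
    , stacking (+ 1) -[1+ 7 + k ] (+ (10 + k)) (+ (9 + k)) -[1+ 8 + k ] S₁ facets₁ isS₂ (∈-++⁺ʳ K (here refl))
        (≈-bring (+ 1 ∷ -[1+ 7 + k ] ∷ [])) (∉³ (λ ()) (λ ()) (λ ())) (≈-bring (+ 1 ∷ -[1+ 7 + k ] ∷ []))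
        (∉-by vertices₁ λ { (inj₁ (_ , ())) ; (inj₂ (here ())) }) (λ ()) (λ ()) (λ ()) only-S₁⊇1n
    , stacking (+ 1) -[1+ 7 + k ] -[1+ 8 + k ] (+ (10 + k)) -[1+ 9 + k ] S₂ facets₂ isS₃ (∈-++⁺ʳ K₁ (here refl))
        (≈-bring (+ 1 ∷ -[1+ 7 + k ] ∷ -[1+ 8 + k ] ∷ [])) (∉³ (λ ()) (λ ()) (λ ()))
        (≈-bring (+ 1 ∷ -[1+ 7 + k ] ∷ -[1+ 8 + k ] ∷ []))
        (∉-by vertices₂ λ { (inj₁ (_ , ())) ; (inj₂ (here ())) ; (inj₂ (there (here ()))) }) (λ ()) (λ ()) (λ ()) only-S₂⊇1
    , tt )
    , subst (FanPhase 2) (≡-trans (++-assoc K₁ [ S₂ ] [ S₃ ]) (++-assoc K [ S₁ ] (S₂ ∷ S₃ ∷ []))) record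
      { facets = ++⁺ facets₂ (isS₃ ∷ [])
      ; vertices = weaken to-fan vertices₂
          ∷ᴬ (inj₁ (1 , refl) ∷ neg≥ ℕ.≤-refl ∷ neg≥ (ℕ.n≤1+n _) ∷ neg≥ (ℕ.m≤n+m _ 2) ∷ [])
      ; S₁∈ = ∈-++⁺ˡ (∈-++⁺ˡ (∈-++⁺ʳ K (here refl)))
      ; A∈ = λ i 3≤i i≤ → ∈-++⁺ˡ (∈-++⁺ˡ (∈-++⁺ˡ (A∈ i 3≤i i≤)))
      ; previous = inj₁ refl }
    where
    open APhase inv
    K₁ K₂ : Complex
    K₁ = K ++ [ S₁ ]
    K₂ = K₁ ++ [ S₂ ]
    positive : ∀ {v} → AVertex 0 v → Positive v
    positive (inj₁ refl) = 1 , refl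
    positive (inj₂ (inj₁ refl)) = 2 , refl
    positive (inj₂ (inj₂ (p , refl , _))) = p , refl
    neg≥ : ∀ {u} → 7 + k ≤ u → NegVertex 2 -[1+ u ]
    neg≥ 7+k≤u = inj₂ (_ , refl , ℕ.≤-trans (ℕ.≤-reflexive (ℕ.+-comm 2 (7 + k))) (ℕ.+-monoˡ-≤ 2 7+k≤u))
    facets₁ : AllFacets K₁
    facets₁ = ++⁺ facets (isS₁ ∷ [])
    facets₂ : AllFacets K₂
    facets₂ = ++⁺ facets₁ (isS₂ ∷ [])
    vertices₁ : VerticesIn (λ v → Positive v ⊎ v ∈ -[1+ 7 + k ] ∷ []) K₁
    vertices₁ = weaken (λ v → inj₁ (positive v)) vertices
      ∷ᴬ (inj₁ (_ , refl) ∷ inj₂ (here refl) ∷ inj₁ (_ , refl) ∷ inj₁ (_ , refl) ∷ [])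
    vertices₂ : VerticesIn (λ v → Positive v ⊎ v ∈ -[1+ 7 + k ] ∷ -[1+ 8 + k ] ∷ []) K₂
    vertices₂ = weaken (λ { (inj₁ p) → inj₁ p ; (inj₂ (here refl)) → inj₂ (here refl) }) vertices₁
      ∷ᴬ (inj₁ (_ , refl) ∷ inj₂ (here refl) ∷ inj₂ (there (here refl)) ∷ inj₁ (_ , refl) ∷ [])
    to-fan : ∀ {v} → Positive v ⊎ v ∈ -[1+ 7 + k ] ∷ -[1+ 8 + k ] ∷ [] → NegVertex 2 v
    to-fan (inj₁ p) = inj₁ p
    to-fan (inj₂ (here refl)) = neg≥ ℕ.≤-refl
    to-fan (inj₂ (there (here refl))) = neg≥ (ℕ.n≤1+n _)

  private
    fan-fresh : ∀ {m s} → m + s ≡ 8 + k → ¬ NegVertex m -[1+ s ]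
    fan-fresh {m} {s} m+s≡ (inj₂ (_ , refl , 9+k≤)) =
      1+d+n≰n 0 (ℕ.≤-trans 9+k≤ (ℕ.≤-reflexive (≡-trans (ℕ.+-comm s m) m+s≡)))

    negVertex-suc : ∀ {m v} → NegVertex m v → NegVertex (suc m) v
    negVertex-suc (inj₁ p) = inj₁ p
    negVertex-suc {m} (inj₂ (u , refl , 9+k≤)) = inj₂ (u , refl , ℕ.≤-trans 9+k≤ (ℕ.≤-trans (ℕ.n≤1+n _) (ℕ.≤-reflexive (sym (ℕ.+-suc u m)))))

    new-negatives : ∀ {m s} → m + s ≡ 8 + k → All (NegVertex (suc m)) (-[1+ s ] ∷ -[1+ suc s ] ∷ [])
    new-negatives {m} {s} m+s≡ = inj₂ (s , refl , 9+k≤) ∷ inj₂ (suc s , refl , ℕ.≤-trans 9+k≤ (ℕ.n≤1+n _)) ∷ []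
      where
      9+k≤ : 9 + k ≤ s + suc m
      9+k≤ = ℕ.≤-reflexive (sym (≡-trans (ℕ.+-suc s m) (cong suc (≡-trans (ℕ.+-comm s m) m+s≡))))

    2≤ : ∀ {m K} → FanPhase m K → 2 ≤ m
    2≤ inv with FanPhase.previous inv
    ... | inj₁ refl = ℕ.≤-refl
    ... | inj₂ (_ , refl , 2≤m′ , _) = ℕ.m≤n⇒m≤1+n 2≤m′

    next-fan : ∀ {m K} s → AllFacets K → VerticesIn (NegVertex m) K → suc s ≤ 6 + k → Fan (suc s) ∈ K →
               ¬ NegVertex m -[1+ s ] → Stacking K (Fan s)
    next-fan s facets vertices 1+s≤ T∈ fresh =
      stacking -[1+ suc s ] (+ (9 + k)) (+ (10 + k)) -[1+ 2 + s ] -[1+ s ] (Fan (suc s)) facets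
        (isFan s (ℕ.≤-trans (ℕ.n≤1+n s) 1+s≤)) T∈
        (≈-bring (-[1+ suc s ] ∷ [])) (∉³ (λ ()) (λ ()) (λ ())) (≈-bring []) (∉-by vertices fresh)
        (λ ()) (λ ()) (λ ()) (only-Fan⊇n s 1+s≤)

    fan-stacking : ∀ {I m K} → AllIn n I → m ≤ next I → FanPhase m K → Stacking K (Fan′ m)
    fan-stacking {K = K} I∈ m≤ inv with FanPhase.previous inv
    ... | inj₁ refl = subst (Stacking K) (sym (Fan′≡Fan {2} {6 + k} refl))
      (stacking -[1+ 7 + k ] (+ (9 + k)) (+ (10 + k)) (+ 1) -[1+ 6 + k ] S₁ facets (isFan _ ℕ.≤-refl) S₁∈
        (≈-bring []) (∉³ (λ ()) (λ ()) (λ ())) (≈-bring []) (∉-by vertices (fan-fresh refl)) (λ ()) (λ ()) (λ ()) only-S₁⊇n)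
      where open FanPhase inv
    ... | inj₂ (m′ , refl , 2≤m′ , prev∈) = subst (Stacking K) (sym (Fan′≡Fan m+s≡))
      (next-fan s facets vertices 1+s≤ (subst (_∈ K) (Fan′≡Fan m′+[1+s]≡) prev∈) (fan-fresh m+s≡))
      where
      open FanPhase inv
      s = 8 + k ∸ suc m′
      m+s≡ : suc m′ + s ≡ 8 + k
      m+s≡ = ℕ.m+[n∸m]≡n (ℕ.≤-trans m≤ (next≤ I∈))
      m′+[1+s]≡ : m′ + suc s ≡ 8 + k
      m′+[1+s]≡ = ≡-trans (ℕ.+-suc m′ s) m+s≡
      1+s≤ : suc s ≤ 6 + k
      1+s≤ = ℕ.+-cancelˡ-≤ 2 (suc s) (6 + k) (ℕ.≤-trans (ℕ.+-monoˡ-≤ (suc s) 2≤m′) (ℕ.≤-reflexive m′+[1+s]≡))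

    fan-step : ∀ {I m K} → AllIn n I → m ≤ next I → FanPhase m K → Stacking K (Fan′ m) × FanPhase (suc m) (K ++ [ Fan′ m ])
    fan-step {I} {m} {K} I∈ m≤ inv = fan-stacking I∈ m≤ inv , record
      { facets = ++⁺ facets (isFan′ m (2≤ inv) (ℕ.≤-trans m≤ (next≤ I∈)) ∷ [])
      ; vertices = weaken negVertex-suc vertices
          ∷ᴬ subst (All (NegVertex (suc m))) (sym (Fan′≡Fan m+s≡)) (++⁺ (new-negatives m+s≡) (inj₁ (_ , refl) ∷ inj₁ (_ , refl) ∷ []))
      ; S₁∈ = ∈-++⁺ˡ S₁∈
      ; A∈ = λ i 3≤i i≤ → ∈-++⁺ˡ (A∈ i 3≤i i≤)
      ; previous = inj₂ (m , refl , 2≤ inv , ∈-++⁺ʳ K (here refl)) }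
      where
      open FanPhase inv
      m+s≡ : m + (8 + k ∸ m) ≡ 8 + k
      m+s≡ = ℕ.m+[n∸m]≡n (ℕ.≤-trans m≤ (next≤ I∈))

  fan-phase : List ℕ → List Face
  fan-phase I = map Fan′ (range 2 (next I))

  stack-fans : ∀ {I K} → AllIn n I → FanPhase 2 K →
               StackingSequence K (fan-phase I) × FanPhase (suc (next I)) (K ++ fan-phase I)
  stack-fans {I} I∈ = StackingSequence-range Fan′ FanPhase (fan-step I∈) 2 (ℕ.m≤n⇒m≤1+n (2≤next I∈))
    where
    2≤next : ∀ {J} → AllIn n J → 2 ≤ next J
    2≤next [] = s≤s (s≤s z≤n)
    2≤next ((3≤b , _) ∷ _) = ℕ.≤-trans (ℕ.n≤1+n 2) 3≤b

  record BlockPhase (J : List ℕ) (K : Complex) : Set where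
    field
      facets : AllFacets K
      A∈ : ∀ i → 3 ≤ i → i ≤ 8 + k → A i ∈ K
      vertices : VerticesIn (NegVertex (suc (next J))) K

  record BlockRun (a m : ℕ) (K : Complex) : Set where
    field
      facets : AllFacets K
      A∈ : ∀ i → 3 ≤ i → i ≤ 8 + k → A i ∈ K
      vertices : VerticesIn (NegVertex m) K
      previous : (m ≡ a + 2 × Head′ a ∈ K) ⊎ ∃[ m′ ] m ≡ suc m′ × a + 2 ≤ m′ × Block′ a m′ ∈ K

  private
    2∉ : ∀ {c} → 3 ≤ c → + 2 ∉ + 1 ∷ + (2 + c) ∷ + (4 + c) ∷ []
    2∉ () (there (here refl))
    2∉ _ (there (there (there ())))

    head-stacking : ∀ {K} c → 3 ≤ c → c ≤ 4 + k → AllFacets K → A (2 + c) ∈ K → ¬ IsVertex -[1+ c ] K → Stacking K (Head c)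
    head-stacking c 3≤c c≤ facets T∈ fresh =
      stacking (+ 1) (+ (2 + c)) (+ (4 + c)) (+ 2) -[1+ c ] (A (2 + c)) facets (isHead c 3≤c c≤) T∈
        (≈-bring (+ 1 ∷ [])) (2∉ 3≤c) (≈-bring (+ 1 ∷ [])) (λ G∈ c∈G → fresh (lose G∈ c∈G))
        (λ ()) (λ ()) (λ ()) (only-A⊇1 c 3≤c c≤)

    first-block : ∀ {K} s → suc s ≤ 4 + k → 3 ≤ suc s → AllFacets K → Head (suc s) ∈ K → ¬ IsVertex -[1+ s ] K →
                  Stacking K (Block (suc s) s)
    first-block s 1+s≤ 3≤ facets T∈ fresh =
      stacking -[1+ suc s ] (+ (3 + s)) (+ (5 + s)) (+ 1) -[1+ s ] (Head (suc s)) facets (isBlock (suc s) s 3≤ 1+s≤ ℕ.≤-refl) T∈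
        (≈-bring []) (∉³ (λ ()) (λ ()) (λ ())) (≈-bring []) (λ G∈ s∈G → fresh (lose G∈ s∈G))
        (λ ()) (λ ()) (λ ()) (only-Head⊇ s 1+s≤)

    next-block : ∀ {K} c s → 2 + s ≤ c → 3 ≤ c → c ≤ 4 + k → AllFacets K → Block c (suc s) ∈ K → ¬ IsVertex -[1+ s ] K →
                 Stacking K (Block c s)
    next-block c s 2+s≤c 3≤c c≤ facets T∈ fresh =
      stacking -[1+ suc s ] (+ (2 + c)) (+ (4 + c)) -[1+ 2 + s ] -[1+ s ] (Block c (suc s)) facets
        (isBlock c s 3≤c c≤ (ℕ.≤-trans (ℕ.n≤1+n _) 2+s≤c)) T∈
        (≈-bring (-[1+ suc s ] ∷ [])) (∉³ (λ ()) (λ ()) (λ ())) (≈-bring []) (λ G∈ s∈G → fresh (lose G∈ s∈G))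
        (λ ()) (λ ()) (λ ()) (only-Block⊇ c s 2+s≤c c≤)

    vertex-fresh : ∀ {P K d} → VerticesIn P K → ¬ P d → ¬ IsVertex d K
    vertex-fresh vertices ¬Pd d∈K = let _ , G∈ , d∈G = find d∈K in ∉-by vertices ¬Pd G∈ d∈G

  module _ {a c rest} (a+c≡ : a + c ≡ 7 + k) (3≤c : 3 ≤ c) (c≤ : c ≤ 4 + k) (next≤′ : next rest ≤ 8 + k) where
    private
      block-stacking : ∀ {m K} → m ≤ next rest → BlockRun a m K → Stacking K (Block′ a m)
      block-stacking {m} {K} m≤ inv with BlockRun.previous inv
      ... | inj₁ (refl , head∈) = subst (Stacking K) (sym (Block′≡Block {a} a+c≡ m+s≡))
        (subst (λ c → Stacking K (Block c s)) (sym c≡)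
          (first-block s (subst (_≤ 4 + k) c≡ c≤) (subst (3 ≤_) c≡ 3≤c) facets
            (subst (λ c → Head c ∈ K) c≡ (subst (_∈ K) (Head′≡Head {a} a+c≡) head∈)) (vertex-fresh vertices (fan-fresh m+s≡))))
        where
        open BlockRun inv
        s = 8 + k ∸ (a + 2)
        m+s≡ : a + 2 + s ≡ 8 + k
        m+s≡ = ℕ.m+[n∸m]≡n (ℕ.≤-trans m≤ next≤′)
        c≡ : c ≡ suc s
        c≡ = ℕ.+-cancelˡ-≡ (a + 2) c (suc s) (≡-trans (a+2+c≡ a c) (≡-trans (cong (2 ℕ.+_) a+c≡)
               (sym (≡-trans (ℕ.+-suc (a + 2) s) (cong suc m+s≡)))))
          where
          a+2+c≡ : ∀ a c → a + 2 + c ≡ 2 + (a + c)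
          a+2+c≡ = solve-∀
      ... | inj₂ (m′ , refl , a+2≤m′ , prev∈) = subst (Stacking K) (sym (Block′≡Block {a} a+c≡ m+s≡))
        (next-block c s (block-s<c a+c≡ m′+[1+s]≡ a+2≤m′) 3≤c c≤ facets
          (subst (_∈ K) (Block′≡Block {a} a+c≡ m′+[1+s]≡) prev∈) (vertex-fresh vertices (fan-fresh m+s≡)))
        where
        open BlockRun inv
        s = 8 + k ∸ suc m′
        m+s≡ : suc m′ + s ≡ 8 + k
        m+s≡ = ℕ.m+[n∸m]≡n (ℕ.≤-trans m≤ next≤′)
        m′+[1+s]≡ : m′ + suc s ≡ 8 + k
        m′+[1+s]≡ = ≡-trans (ℕ.+-suc m′ s) m+s≡

      a+2≤ : ∀ {m K} → BlockRun a m K → a + 2 ≤ m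
      a+2≤ inv with BlockRun.previous inv
      ... | inj₁ (refl , _) = ℕ.≤-refl
      ... | inj₂ (_ , refl , a+2≤m′ , _) = ℕ.m≤n⇒m≤1+n a+2≤m′

    block-step : ∀ {m K} → m ≤ next rest → BlockRun a m K → Stacking K (Block′ a m) × BlockRun a (suc m) (K ++ [ Block′ a m ])
    block-step {m} {K} m≤ inv = block-stacking m≤ inv , record
      { facets = ++⁺ facets (subst IsFacet (sym (Block′≡Block {a} a+c≡ m+s≡)) (isBlock c _ 3≤c c≤ (block-s<c a+c≡ m+s≡ (a+2≤ inv))) ∷ [])
      ; A∈ = λ i 3≤i i≤ → ∈-++⁺ˡ (A∈ i 3≤i i≤)
      ; vertices = weaken negVertex-suc vertices
          ∷ᴬ subst (All (NegVertex (suc m))) (sym (Block′≡Block {a} a+c≡ m+s≡)) (++⁺ (new-negatives m+s≡) (inj₁ (_ , refl) ∷ inj₁ (_ , refl) ∷ []))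
      ; previous = inj₂ (m , refl , a+2≤ inv , ∈-++⁺ʳ K (here refl)) }
      where
      open BlockRun inv
      m+s≡ : m + (8 + k ∸ m) ≡ 8 + k
      m+s≡ = ℕ.m+[n∸m]≡n (ℕ.≤-trans m≤ next≤′)

  private
    <next : ∀ {a rest} → a ≤ 4 + k → Linked _<_ (a ∷ rest) → a < next rest
    <next {rest = []} a≤ _ = s≤s (ℕ.≤-trans a≤ (ℕ.m≤n+m _ 3))
    <next {rest = _ ∷ _} _ (a<b ∷ _) = a<b

  stack-blocks : ∀ J {K} → AllIn n J → Linked _<_ J → BlockPhase J K → StackingSequence K (blocks J)
  stack-blocks [] _ _ _ = tt
  stack-blocks (a ∷ rest) {K} ((3≤a , a≤) ∷ rest∈) linked inv
    with c , a+c≡ , 3≤c , c≤ ← complement a 3≤a a≤ =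
    head , StackingSequence-++ K₁ (map (Block′ a) (range (a + 2) (next rest))) (proj₁ run) (stack-blocks rest rest∈ (Linked.tail linked) inv′)
    where
    open BlockPhase inv
    K₁ = K ++ [ Head′ a ]
    head : Stacking K (Head′ a)
    head = subst (Stacking K) (sym (Head′≡Head {a} a+c≡))
      (head-stacking c 3≤c c≤ facets (A∈ (2 + c) (ℕ.≤-trans 3≤c (ℕ.m≤n+m c 2)) (s≤s (s≤s (ℕ.≤-trans c≤ (ℕ.m≤n+m _ 2)))))
        (vertex-fresh vertices (fan-fresh (cong suc a+c≡))))
    head-vertices : All (NegVertex (a + 2)) (Head c)
    head-vertices = inj₁ (_ , refl) ∷ inj₂ (c , refl , ℕ.≤-reflexive c+[a+2]≡) ∷ inj₁ (_ , refl) ∷ inj₁ (_ , refl) ∷ []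
      where
      c+[a+2]≡ : 9 + k ≡ c + (a + 2)
      c+[a+2]≡ = ≡-trans (cong (2 ℕ.+_) (sym a+c≡)) (shuffle a c)
        where
        shuffle : ∀ a c → 2 + (a + c) ≡ c + (a + 2)
        shuffle = solve-∀
    run₀ : BlockRun a (a + 2) K₁
    run₀ = record
      { facets = ++⁺ facets (subst IsFacet (sym (Head′≡Head {a} a+c≡)) (isHead c 3≤c c≤) ∷ [])
      ; A∈ = λ i 3≤i i≤ → ∈-++⁺ˡ (A∈ i 3≤i i≤)
      ; vertices = weaken (λ {v} v∈ → subst (λ m → NegVertex m v) (ℕ.+-comm 2 a) (negVertex-suc v∈)) vertices
          ∷ᴬ subst (All (NegVertex (a + 2))) (sym (Head′≡Head {a} a+c≡)) head-vertices
      ; previous = inj₁ (refl , ∈-++⁺ʳ K (here refl)) }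
    run = StackingSequence-range (Block′ a) (BlockRun a) (block-step {rest = rest} a+c≡ 3≤c c≤ (next≤ rest∈)) (a + 2)
            (subst (_≤ suc (next rest)) (ℕ.+-comm 2 a) (s≤s (<next a≤ linked))) run₀
    inv′ : BlockPhase rest (K₁ ++ map (Block′ a) (range (a + 2) (next rest)))
    inv′ = record { facets = BlockRun.facets (proj₂ run) ; A∈ = BlockRun.A∈ (proj₂ run) ; vertices = BlockRun.vertices (proj₂ run) }

  stacking-order : List ℕ → List Face
  stacking-order I = A-phase ++ S-phase ++ fan-phase I ++ blocks I

  stackingSequence : ∀ {I} → AllIn n I → Linked _<_ I → StackingSequence [ S₀ ] (stacking-order I)
  stackingSequence {I} I∈ linked =
    let seqA , invA = stack-A (6 + k) initial
        seqS , invS = stack-S invA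
        seqF , invF = stack-fans I∈ invS
        open FanPhase invF
        seqB = stack-blocks I I∈ linked record { facets = facets ; A∈ = A∈ ; vertices = vertices }
    in StackingSequence-++ [ S₀ ] A-phase seqA
         (StackingSequence-++ _ S-phase seqS (StackingSequence-++ _ (fan-phase I) seqF seqB))
    where
    initial : APhase (6 + k) [ S₀ ]
    initial = record
      { x≤ = ℕ.≤-refl
      ; facets = isS₀ ∷ []
      ; vertices = (inj₁ refl ∷ inj₂ (inj₁ refl) ∷ inj₂ (inj₂ (_ , refl , ℕ.≤-refl)) ∷ inj₂ (inj₂ (_ , refl , ℕ.n≤1+n _)) ∷ []) ∷ []
      ; S₀∈ = here refl
      ; A∈ = λ i 9+k≤i i≤ → ⊥-elim (1+d+n≰n 0 (ℕ.≤-trans 9+k≤i i≤)) }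

module Assembly (k : ℕ) where
  open Facets k
  open Vertices k
  open BIStacking k

  stacking-order⊆BI′ : ∀ I {F} → F ∈ S₀ ∷ stacking-order I → F ∈ BI′ I
  stacking-order⊆BI′ I (here refl) = ∈BI′-special I (here refl)
  stacking-order⊆BI′ I (there F∈) with ∈-++⁻ A-phase F∈
  ... | inj₁ F∈A with x , x∈ , refl ← ∈-map⁻ _ F∈A = ∈BI′-A I (s≤s (s≤s (s≤s z≤n))) (s≤s (s≤s (s≤s (ℕ.≤-pred (∈-downFrom⁻ x∈)))))
  ... | inj₂ (here refl) = ∈BI′-special I (there (here refl))
  ... | inj₂ (there (here refl)) = ∈BI′-special I (there (there (here refl)))
  ... | inj₂ (there (there (here refl))) = ∈BI′-special I (there (there (there (here refl))))
  ... | inj₂ (there (there (there F∈′))) with ∈-++⁻ (fan-phase I) F∈′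
  ...   | inj₁ F∈fan = ∈BI′-fan I F∈fan
  ...   | inj₂ F∈blocks = ∈BI′-blocks I F∈blocks

  BI′⊆stacking-order : ∀ I {F} → F ∈ BI′ I → F ∈ S₀ ∷ stacking-order I
  BI′⊆stacking-order I F∈ with ∈-++⁻ (map A′ (range 3 (8 + k))) F∈
  ... | inj₁ F∈A with i , i∈ , refl ← ∈-map⁻ A′ F∈A with ∈-range⁻ 3 (8 + k) i∈
  ...   | 3≤i , i≤ = there (∈-++⁺ˡ (subst (_∈ A-phase) A≡ (∈-map⁺ (λ x → A (3 + x)) (∈-downFrom⁺ i-3<))))
    where
    A≡ : A (3 + (i ∸ 3)) ≡ A′ i
    A≡ = subst (λ j → A j ≡ A′ i) (sym (ℕ.m+[n∸m]≡n 3≤i)) (sym (A′≡A i))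
    i-3< : i ∸ 3 < 6 + k
    i-3< = s≤s (ℕ.∸-monoˡ-≤ 3 i≤)
  BI′⊆stacking-order I F∈ | inj₂ (here refl) = here refl
  BI′⊆stacking-order I F∈ | inj₂ (there (here refl)) = there (∈-++⁺ʳ A-phase (here refl))
  BI′⊆stacking-order I F∈ | inj₂ (there (there (here refl))) = there (∈-++⁺ʳ A-phase (there (here refl)))
  BI′⊆stacking-order I F∈ | inj₂ (there (there (there (here refl)))) = there (∈-++⁺ʳ A-phase (there (there (here refl))))
  BI′⊆stacking-order I F∈ | inj₂ (there (there (there (there F∈′)))) = there (∈-++⁺ʳ A-phase (there (there (there F∈′))))

  BI′-stacked : ∀ {I} → AllIn n I → Linked _<_ I → IsStacked 3 1 (BI′ I)
  BI′-stacked {I} I∈ linked =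
    StackingSequence⇒IsStacked (unique⁴ (λ ()) (λ ()) (λ ()) (λ ()) (λ ()) (λ ())) refl (stackingSequence I∈ linked)
                (stacking-order⊆BI′ I) (BI′⊆stacking-order I)

lemma7p4 : (n : ℕ) → 10 ≤ n → (I : List ℕ) → InI n I →
    IsCombBall 3 (BI n I) × SubComplex (BI n I) (Δ3 n) × VertexSetIsV n (BI n I)
      × IsStacked 3 1 (BI n I) × NoCommonFacet (BI n I) (negC (BI n I))
lemma7p4 n 10≤n I (linked , I∈ , _) with k , refl ← ℕ.m≤n⇒∃[o]m+o≡n 10≤n =
  subst Claim (sym (BI≡BI′ n I)) (proj₁ stacked , ⊆Δ3 , vertexSet I∈ , stacked , no-common-facet)
  where
  Claim : Complex → Set
  Claim B = IsCombBall 3 B × SubComplex B (Δ3 n) × VertexSetIsV n B × IsStacked 3 1 B × NoCommonFacet B (negC B)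
  open Facets k using (BI′; isFacet)
  open Containment k using (facet⊆Δ3)
  open Vertices k using (vertexSet)
  open Antipodal k using (no-antipodal-facets)
  open Assembly k using (BI′-stacked)
  stacked : IsStacked 3 1 (BI′ I)
  stacked = BI′-stacked I∈ linked
  ⊆Δ3 : SubComplex (BI′ I) (Δ3 n)
  ⊆Δ3 σ σ∈ = let F , F∈ , σ⊆F = find σ∈ in IsFace-⊆ σ⊆F (facet⊆Δ3 (isFacet I∈ F∈))
  no-common-facet : NoCommonFacet (BI′ I) (negC (BI′ I))
  no-common-facet F G F∈ G∈ (F⊆G , G⊆F) with G₀ , G₀∈ , refl ← ∈-map⁻ _ G∈ =
    no-antipodal-facets (isFacet I∈ F∈) (isFacet I∈ G₀∈) F⊆G G⊆F
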